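{- Let $\overline{\mathcal{S}}$ be the set of strict overpartitions: partitions $\lambda=(\lambda_1>\cdots>\lambda_\ell)$ into distinct positive parts in which a part $\lambda_i$ may be overlined only if $\lambda_i\ge2$ and $\lambda_i-\lambda_{i+1}\ge2$ (with $\lambda_{\ell+1}:=0$); the empty partition is included. Then $$\sum_{\lambda\in\overline{\mathcal{S}}}a^{\overline{\#}(\lambda)}z^{\#(\lambda)}q^{|\lambda|}=\sum_{n=0}^{\infty}\frac{(-aq;q)_{n}}{(q;q)_{n}}z^nq^{\frac{n(n+1)}{2}}=(-aq;q)_\infty (-zq;q)_\infty\sum_{n\ge 0}\frac{(-aq)^n}{(q;q)_n(-zq;q)_n}.$$
   Context: $\overline{\#}(\lambda)$ is the number of overlined parts, $\#(\lambda)$ the number of parts, $|\lambda|$ the sum of the parts (ignoring overlines). $(a;q)_n=\prod_{i=0}^{n-1}(1-aq^i)$ for $n\in\mathbb{Z}_{\ge0}\cup\{\infty\}$, $|q|<1$. -}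

module Defs where

open import Data.Nat as ℕ using (ℕ; zero; suc; _≤_; _<_; _≟_)
open import Data.Nat.DivMod using (_/_)
open import Data.Integer as ℤ using (ℤ; +_; 0ℤ; 1ℤ; -1ℤ)
open import Data.Bool using (Bool; true; false; if_then_else_; _∧_)
open import Data.List using (List; []; _∷_)
open import Data.Product using (_×_; _,_; Σ)
open import Data.Unit using (⊤)
open import Relation.Nullary.Decidable using (⌊_⌋)
open import Relation.Binary.PropositionalEquality using (_≡_)

-- Strict overpartitions
-- An overpartition is a list of (part , overlined?) listed in the order
-- λ₁, λ₂, …, λ_ℓ.

OPart : Set
OPart = List (ℕ × Bool)

next : OPart → ℕ
next []            = 0
next ((p , _) ∷ _) = p

OvOK : Bool → ℕ → ℕ → Set
OvOK false p m = ⊤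
OvOK true  p m = (2 ≤ p) × (2 ℕ.+ m ≤ p)

-- strictly decreasing positive parts (next rest < p, and next [] = 0
-- forces positivity) with the overlining condition
IsStrictOverpartition : OPart → Set
IsStrictOverpartition []              = ⊤
IsStrictOverpartition ((p , b) ∷ rest) =
  IsStrictOverpartition rest × (next rest < p) × OvOK b p (next rest)

size : OPart → ℕ
size []            = 0
size ((p , _) ∷ l) = p ℕ.+ size l

numParts : OPart → ℕ
numParts []      = 0
numParts (_ ∷ l) = suc (numParts l)

numOver : OPart → ℕ
numOver []                = 0
numOver ((_ , true)  ∷ l) = suc (numOver l)
numOver ((_ , false) ∷ l) = numOver l

SOP : ℕ → ℕ → ℕ → Set
SOP i j N = Σ OPart λ l →
  IsStrictOverpartition l × (numOver l ≡ i) × (numParts l ≡ j) × (size l ≡ N)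

-- Formal power series in a, z, q with integer coefficients:
-- f i j N = coefficient of a^i z^j q^N.

Ser : Set
Ser = ℕ → ℕ → ℕ → ℤ

sumTo : ℕ → (ℕ → ℤ) → ℤ
sumTo zero    f = f 0
sumTo (suc n) f = sumTo n f ℤ.+ f (suc n)

_⊕_ : Ser → Ser → Ser
(f ⊕ g) i j N = f i j N ℤ.+ g i j N

_⊗_ : Ser → Ser → Ser
(f ⊗ g) i j N =
  sumTo i λ i₁ → sumTo j λ j₁ → sumTo N λ n₁ →
    f i₁ j₁ n₁ ℤ.* g (i ℕ.∸ i₁) (j ℕ.∸ j₁) (N ℕ.∸ n₁)

infixl 6 _⊕_
infixl 7 _⊗_

mono : ℤ → ℕ → ℕ → ℕ → Ser
mono c α β k i j N =
  if ⌊ i ≟ α ⌋ ∧ ⌊ j ≟ β ⌋ ∧ ⌊ N ≟ k ⌋ then c else 0ℤ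

one : Ser
one = mono 1ℤ 0 0 0

prod1to : ℕ → (ℕ → Ser) → Ser
prod1to zero    F = one
prod1to (suc n) F = prod1to n F ⊗ F (suc n)

-- (x;q)_n with x = -s a^α z^β q :  ∏_{k=1}^{n} (1 + s a^α z^β q^k)
poch : ℤ → ℕ → ℕ → ℕ → Ser
poch s α β n = prod1to n λ k → one ⊕ mono s α β k

-- (x;q)_∞ : the coefficient of q^N only depends on the factors k ≤ N
pochInf : ℤ → ℕ → ℕ → Ser
pochInf s α β i j N = poch s α β N i j N

-- 1 / (1 + s a^α z^β q^k) = Σ_{m≥0} (-s)^m a^{αm} z^{βm} q^{km}   (k ≥ 1,
-- so only m ≤ N contributes to q^N)
geomInv : ℤ → ℕ → ℕ → ℕ → Ser
geomInv s α β k i j N =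
  sumTo N λ m → mono ((ℤ.- s) ℤ.^ m) (α ℕ.* m) (β ℕ.* m) (k ℕ.* m) i j N

-- 1 / (x;q)_n  with x = -s a^α z^β q
invPoch : ℤ → ℕ → ℕ → ℕ → Ser
invPoch s α β n = prod1to n λ k → geomInv s α β k

-- Σ_{n≥0} F n, for families where F n has q-order ≥ n
-- (so only n ≤ N contributes to the coefficient of q^N)
sumQ : (ℕ → Ser) → Ser
sumQ F i j N = sumTo N λ n → F n i j N

tri : ℕ → ℕ
tri n = (n ℕ.* suc n) / 2

-- Σ_n (-aq;q)_n / (q;q)_n z^n q^{n(n+1)/2}
rhs1 : Ser
rhs1 = sumQ λ n → poch 1ℤ 1 0 n ⊗ invPoch -1ℤ 0 0 n ⊗ mono 1ℤ 0 n (tri n)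

-- (-aq;q)_∞ (-zq;q)_∞ Σ_n (-aq)^n / ((q;q)_n (-zq;q)_n)
rhs2 : Ser
rhs2 = pochInf 1ℤ 1 0 ⊗ pochInf 1ℤ 0 1 ⊗
       sumQ (λ n → mono (-1ℤ ℤ.^ n) n 0 n ⊗ invPoch -1ℤ 0 0 n ⊗ invPoch 1ℤ 0 1 n)

-- A strict overpartition with j parts is classified by its smallest part: it is 1, it is 2̄, or it is
-- at least 2 and not 2̄. Subtracting 1 from every part (and dropping a part 1), respectively 2 (and
-- dropping the 2̄), shows that the generating function G(a,z,q) satisfies the q-difference equation
--   G(z) = (1 + zq) G(zq) + a z q² G(zq²),   G(a,0,q) = 1,
-- which determines G coefficient by coefficient (induction on the power of z, then on that of q).
-- The first sum satisfies it because its terms t_n obey (1 - q^{n+1}) t_{n+1} = (1 + aq^{n+1}) z q^{n+1} t_n.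
-- For the product, (-zq;q)_∞ = (1 + zq)(-zq²;q)_∞ reduces the equation to a telescoping identity for
-- S(z) = Σ_n (-aq)^n/((q;q)_n (-zq;q)_n), and at z = 0 it becomes Euler's identity
-- Σ_n (-aq)^n/(q;q)_n = 1/(-aq;q)_∞, which follows from invariance under a ↦ aq.

module Submission where

open import Level using (0ℓ)
open import Algebra.Bundles using (CommutativeRing)
open import Data.Bool using (Bool; true; false; _∧_)
open import Data.Bool.Properties using (∧-zeroʳ)
open import Data.Empty using (⊥; ⊥-elim)
open import Data.Fin using (Fin)
import Data.Fin
open import Data.Fin.Properties using (+↔⊎; 0↔⊥)
open import Data.Integer as ℤ using (ℤ; +_; 0ℤ; 1ℤ; -1ℤ)
import Data.Integer.Properties as ℤₚ
open import Data.Integer.Solver using () renaming (module +-*-Solver to ℤ-Solver)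
open import Data.List using ([]; _∷_)
open import Data.Nat as ℕ using (ℕ; zero; suc; _≤_; _<_; _∸_; z≤n; s≤s)
open import Data.Nat.DivMod using (_/_; +-distrib-/-∣ʳ; m*n/n≡m)
open import Data.Nat.Divisibility using (divides)
open import Data.Nat.Induction using (<-rec)
import Data.Nat.Properties as ℕₚ
open import Data.Nat.Solver using (module +-*-Solver)
open import Data.Product using (Σ; _×_; _,_; proj₁; proj₂)
open import Data.Sum using (_⊎_; inj₁; inj₂)
import Data.Sum
open import Data.Sum.Function.Propositional using (_⊎-↔_)
open import Data.Unit using (tt)
open import Function using (_∘_)
open import Function.Bundles using (_↔_; mk↔ₛ′)
open import Function.Properties.Inverse using (↔-trans; ↔-sym)
open import Relation.Binary.Bundles using (Setoid)
import Relation.Binary.Reasoning.Setoid as SetoidReasoning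
open import Relation.Binary.PropositionalEquality as ≡ using (_≡_; _≢_; refl)
open import Relation.Nullary using (Dec; yes; no)
open import Relation.Nullary.Decidable using (⌊_⌋; isYes≗does; dec-true; dec-false)

open import Defs

-- Finite sums and power series over a commutative ring

module FiniteSum {c ℓ} (R : CommutativeRing c ℓ) where
  open CommutativeRing R hiding (zero) renaming (refl to ≈-refl)
  open SetoidReasoning setoid

  ∑≤ : ℕ → (ℕ → Carrier) → Carrier
  ∑≤ zero    f = f 0
  ∑≤ (suc n) f = ∑≤ n f + f (suc n)

  ∑≤-cong : ∀ n {f g : ℕ → Carrier} → (∀ k → k ≤ n → f k ≈ g k) → ∑≤ n f ≈ ∑≤ n g
  ∑≤-cong zero    f≈g = f≈g 0 z≤n
  ∑≤-cong (suc n) f≈g = +-cong (∑≤-cong n (λ k k≤n → f≈g k (ℕₚ.m≤n⇒m≤1+n k≤n))) (f≈g (suc n) ℕₚ.≤-refl)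

  ∑≤-zero : ∀ n {f : ℕ → Carrier} → (∀ k → k ≤ n → f k ≈ 0#) → ∑≤ n f ≈ 0#
  ∑≤-zero zero    f≈0 = f≈0 0 z≤n
  ∑≤-zero (suc n) f≈0 =
    trans (+-cong (∑≤-zero n (λ k k≤n → f≈0 k (ℕₚ.m≤n⇒m≤1+n k≤n))) (f≈0 (suc n) ℕₚ.≤-refl)) (+-identityˡ 0#)

  ∑≤-distrib-+ : ∀ n (f g : ℕ → Carrier) → ∑≤ n (λ k → f k + g k) ≈ ∑≤ n f + ∑≤ n g
  ∑≤-distrib-+ zero    f g = ≈-refl
  ∑≤-distrib-+ (suc n) f g = begin
    ∑≤ n (λ k → f k + g k) + (f (suc n) + g (suc n)) ≈⟨ +-congʳ (∑≤-distrib-+ n f g) ⟩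
    (∑≤ n f + ∑≤ n g) + (f (suc n) + g (suc n))      ≈⟨ +-interchange (∑≤ n f) (∑≤ n g) (f (suc n)) (g (suc n)) ⟩
    (∑≤ n f + f (suc n)) + (∑≤ n g + g (suc n))      ∎
    where
    open import Algebra.Properties.CommutativeSemigroup +-commutativeSemigroup using () renaming (interchange to +-interchange)

  *-distribˡ-∑≤ : ∀ n x (f : ℕ → Carrier) → x * ∑≤ n f ≈ ∑≤ n (λ k → x * f k)
  *-distribˡ-∑≤ zero    x f = ≈-refl
  *-distribˡ-∑≤ (suc n) x f = trans (distribˡ x _ _) (+-congʳ (*-distribˡ-∑≤ n x f))

  *-distribʳ-∑≤ : ∀ n x (f : ℕ → Carrier) → ∑≤ n f * x ≈ ∑≤ n (λ k → f k * x)
  *-distribʳ-∑≤ zero    x f = ≈-refl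
  *-distribʳ-∑≤ (suc n) x f = trans (distribʳ x _ _) (+-congʳ (*-distribʳ-∑≤ n x f))

  -‿distrib-∑≤ : ∀ n (f : ℕ → Carrier) → - ∑≤ n f ≈ ∑≤ n (λ k → - f k)
  -‿distrib-∑≤ zero    f = ≈-refl
  -‿distrib-∑≤ (suc n) f = trans (sym (⁻¹-∙-comm _ _)) (+-congʳ (-‿distrib-∑≤ n f))
    where open import Algebra.Properties.AbelianGroup +-abelianGroup using (⁻¹-∙-comm)

  ∑≤-unfoldˡ : ∀ n (f : ℕ → Carrier) → ∑≤ (suc n) f ≈ f 0 + ∑≤ n (f ∘ suc)
  ∑≤-unfoldˡ zero    f = ≈-refl
  ∑≤-unfoldˡ (suc n) f = trans (+-congʳ (∑≤-unfoldˡ n f)) (+-assoc _ _ _)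

  ∑≤-extend : ∀ m n {f : ℕ → Carrier} → m ≤ n → (∀ k → m < k → k ≤ n → f k ≈ 0#) → ∑≤ n f ≈ ∑≤ m f
  ∑≤-extend m zero    z≤n  _   = ≈-refl
  ∑≤-extend m (suc n) m≤1+n f≈0 with ℕₚ.m≤n⇒m<n∨m≡n m≤1+n
  ... | inj₂ refl        = ≈-refl
  ... | inj₁ (s≤s m≤n) = trans
    (+-cong (∑≤-extend m n m≤n (λ k m<k k≤n → f≈0 k m<k (ℕₚ.m≤n⇒m≤1+n k≤n))) (f≈0 (suc n) (s≤s m≤n) ℕₚ.≤-refl))
    (+-identityʳ _)

  ∑≤-single : ∀ n m {f : ℕ → Carrier} → m ≤ n → (∀ k → k ≤ n → k ≢ m → f k ≈ 0#) → ∑≤ n f ≈ f m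
  ∑≤-single zero    .zero z≤n  _   = ≈-refl
  ∑≤-single (suc n) m    m≤1+n f≈0 with m ℕ.≟ suc n
  ... | yes refl = trans (+-congʳ (∑≤-zero n (λ k k≤n → f≈0 k (ℕₚ.m≤n⇒m≤1+n k≤n) (ℕₚ.<⇒≢ (s≤s k≤n))))) (+-identityˡ _)
  ... | no  m≢1+n = trans
    (+-cong (∑≤-single n m (ℕₚ.≤-pred (ℕₚ.≤∧≢⇒< m≤1+n m≢1+n)) (λ k k≤n → f≈0 k (ℕₚ.m≤n⇒m≤1+n k≤n)))
            (f≈0 (suc n) ℕₚ.≤-refl (m≢1+n ∘ ≡.sym)))
    (+-identityʳ _)

  ∑≤-reverse : ∀ n (f : ℕ → Carrier) → ∑≤ n f ≈ ∑≤ n (λ k → f (n ∸ k))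
  ∑≤-reverse zero    f = ≈-refl
  ∑≤-reverse (suc n) f = begin
    ∑≤ (suc n) f                                  ≈⟨ ∑≤-unfoldˡ n f ⟩
    f 0 + ∑≤ n (f ∘ suc)                          ≈⟨ +-comm _ _ ⟩
    ∑≤ n (f ∘ suc) + f 0                          ≈⟨ +-congʳ (∑≤-reverse n (f ∘ suc)) ⟩
    ∑≤ n (λ k → f (suc (n ∸ k))) + f 0
      ≈⟨ +-cong (∑≤-cong n (λ k k≤n → reflexive (≡.cong f (≡.sym (ℕₚ.+-∸-assoc 1 k≤n)))))
                (reflexive (≡.cong f (≡.sym (ℕₚ.n∸n≡0 n)))) ⟩
    ∑≤ (suc n) (λ k → f (suc n ∸ k))              ∎

  ∑≤-comm : ∀ m n (φ : ℕ → ℕ → Carrier) → ∑≤ m (λ a → ∑≤ n (φ a)) ≈ ∑≤ n (λ b → ∑≤ m (λ a → φ a b))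
  ∑≤-comm zero    n φ = ≈-refl
  ∑≤-comm (suc m) n φ = trans (+-congʳ (∑≤-comm m n φ)) (sym (∑≤-distrib-+ n _ _))

  ∑≤-triangle : ∀ n (φ : ℕ → ℕ → Carrier) →
    ∑≤ n (λ a → ∑≤ a (λ b → φ b a)) ≈ ∑≤ n (λ b → ∑≤ (n ∸ b) (λ c → φ b (b ℕ.+ c)))
  ∑≤-triangle zero    φ = ≈-refl
  ∑≤-triangle (suc n) φ = begin
    ∑≤ n (λ a → ∑≤ a (λ b → φ b a)) + ∑≤ (suc n) (λ b → φ b (suc n))
      ≈⟨ +-congʳ (∑≤-triangle n φ) ⟩
    ∑≤ n (λ b → ∑≤ (n ∸ b) (λ c → φ b (b ℕ.+ c))) + (∑≤ n (λ b → φ b (suc n)) + φ (suc n) (suc n))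
      ≈⟨ sym (+-assoc _ _ _) ⟩
    ∑≤ n (λ b → ∑≤ (n ∸ b) (λ c → φ b (b ℕ.+ c))) + ∑≤ n (λ b → φ b (suc n)) + φ (suc n) (suc n)
      ≈⟨ +-cong (sym (∑≤-distrib-+ n _ _)) (reflexive (≡.cong (φ (suc n)) (≡.sym (ℕₚ.+-identityʳ (suc n))))) ⟩
    ∑≤ n (λ b → ∑≤ (n ∸ b) (λ c → φ b (b ℕ.+ c)) + φ b (suc n)) + φ (suc n) (suc n ℕ.+ 0)
      ≈⟨ +-cong (∑≤-cong n (λ b b≤n → sym (lastRow b b≤n)))
                (reflexive (≡.cong (λ m → ∑≤ m (λ c → φ (suc n) (suc n ℕ.+ c))) (≡.sym (ℕₚ.n∸n≡0 (suc n))))) ⟩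
    ∑≤ (suc n) (λ b → ∑≤ (suc n ∸ b) (λ c → φ b (b ℕ.+ c))) ∎
    where
    lastRow : ∀ b → b ≤ n →
      ∑≤ (suc n ∸ b) (λ c → φ b (b ℕ.+ c)) ≈ ∑≤ (n ∸ b) (λ c → φ b (b ℕ.+ c)) + φ b (suc n)
    lastRow b b≤n rewrite ℕₚ.+-∸-assoc 1 b≤n =
      +-congˡ (reflexive (≡.cong (φ b) (≡.trans (ℕₚ.+-suc b (n ∸ b)) (≡.cong suc (ℕₚ.m+[n∸m]≡n b≤n)))))

module PowerSeries {c ℓ} (R : CommutativeRing c ℓ) where
  open CommutativeRing R hiding (zero) renaming (refl to ≈-refl)
  open FiniteSum R
  open SetoidReasoning setoid

  Series : Set c
  Series = ℕ → Carrier

  _≈ₚ_ : Series → Series → Set ℓ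
  f ≈ₚ g = ∀ n → f n ≈ g n

  _+ₚ_ : Series → Series → Series
  (f +ₚ g) n = f n + g n

  -ₚ_ : Series → Series
  (-ₚ f) n = - f n

  0ₚ : Series
  0ₚ _ = 0#

  1ₚ : Series
  1ₚ zero    = 1#
  1ₚ (suc _) = 0#

  _*ₚ_ : Series → Series → Series
  (f *ₚ g) n = ∑≤ n (λ k → f k * g (n ∸ k))

  *ₚ-cong : ∀ {f f′ g g′} → f ≈ₚ f′ → g ≈ₚ g′ → (f *ₚ g) ≈ₚ (f′ *ₚ g′)
  *ₚ-cong f≈f′ g≈g′ n = ∑≤-cong n (λ k _ → *-cong (f≈f′ k) (g≈g′ (n ∸ k)))

  *ₚ-comm : ∀ f g → (f *ₚ g) ≈ₚ (g *ₚ f)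
  *ₚ-comm f g n = begin
    ∑≤ n (λ k → f k * g (n ∸ k))             ≈⟨ ∑≤-reverse n _ ⟩
    ∑≤ n (λ k → f (n ∸ k) * g (n ∸ (n ∸ k)))
      ≈⟨ ∑≤-cong n (λ k k≤n → trans (*-comm _ _) (*-congʳ (reflexive (≡.cong g (ℕₚ.m∸[m∸n]≡n k≤n))))) ⟩
    ∑≤ n (λ k → g k * f (n ∸ k))             ∎

  *ₚ-assoc : ∀ f g h → ((f *ₚ g) *ₚ h) ≈ₚ (f *ₚ (g *ₚ h))
  *ₚ-assoc f g h n = begin
    ∑≤ n (λ a → ∑≤ a (λ b → f b * g (a ∸ b)) * h (n ∸ a))
      ≈⟨ ∑≤-cong n (λ a _ → *-distribʳ-∑≤ a _ _) ⟩
    ∑≤ n (λ a → ∑≤ a (λ b → f b * g (a ∸ b) * h (n ∸ a)))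
      ≈⟨ ∑≤-triangle n _ ⟩
    ∑≤ n (λ b → ∑≤ (n ∸ b) (λ c → f b * g (b ℕ.+ c ∸ b) * h (n ∸ (b ℕ.+ c))))
      ≈⟨ ∑≤-cong n (λ b _ → ∑≤-cong (n ∸ b) (λ c _ → trans (*-assoc _ _ _)
           (*-congˡ (*-cong (reflexive (≡.cong g (ℕₚ.m+n∸m≡n b c))) (reflexive (≡.cong h (≡.sym (ℕₚ.∸-+-assoc n b c)))))))) ⟩
    ∑≤ n (λ b → ∑≤ (n ∸ b) (λ c → f b * (g c * h (n ∸ b ∸ c))))
      ≈⟨ ∑≤-cong n (λ b _ → sym (*-distribˡ-∑≤ (n ∸ b) _ _)) ⟩
    ∑≤ n (λ b → f b * ∑≤ (n ∸ b) (λ c → g c * h (n ∸ b ∸ c))) ∎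

  *ₚ-identityˡ : ∀ f → (1ₚ *ₚ f) ≈ₚ f
  *ₚ-identityˡ f zero    = *-identityˡ _
  *ₚ-identityˡ f (suc n) = begin
    ∑≤ (suc n) (λ k → 1ₚ k * f (suc n ∸ k))    ≈⟨ ∑≤-unfoldˡ n _ ⟩
    1# * f (suc n) + ∑≤ n (λ k → 0# * f (n ∸ k)) ≈⟨ +-cong (*-identityˡ _) (∑≤-zero n (λ k _ → zeroˡ _)) ⟩
    f (suc n) + 0#                                ≈⟨ +-identityʳ _ ⟩
    f (suc n)                                     ∎

  *ₚ-distribˡ-+ₚ : ∀ f g h → (f *ₚ (g +ₚ h)) ≈ₚ ((f *ₚ g) +ₚ (f *ₚ h))
  *ₚ-distribˡ-+ₚ f g h n = trans (∑≤-cong n (λ k _ → distribˡ _ _ _)) (∑≤-distrib-+ n _ _)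

  powerSeriesRing : CommutativeRing c ℓ
  powerSeriesRing = record
    { Carrier = Series ; _≈_ = _≈ₚ_ ; _+_ = _+ₚ_ ; _*_ = _*ₚ_ ; -_ = -ₚ_ ; 0# = 0ₚ ; 1# = 1ₚ
    ; isCommutativeRing = record
      { isRing = record
        { +-isAbelianGroup = record
          { isGroup = record
            { isMonoid = record
              { isSemigroup = record
                { isMagma = record
                  { isEquivalence = record
                    { refl = λ _ → ≈-refl ; sym = λ f≈g n → sym (f≈g n) ; trans = λ f≈g g≈h n → trans (f≈g n) (g≈h n) }
                  ; ∙-cong = λ f≈f′ g≈g′ n → +-cong (f≈f′ n) (g≈g′ n) }
                ; assoc = λ f g h n → +-assoc _ _ _ }
              ; identity = (λ f n → +-identityˡ _) , (λ f n → +-identityʳ _) }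
            ; inverse = (λ f n → -‿inverseˡ _) , (λ f n → -‿inverseʳ _)
            ; ⁻¹-cong = λ f≈g n → -‿cong (f≈g n) }
          ; comm = λ f g n → +-comm _ _ }
        ; *-cong = *ₚ-cong
        ; *-assoc = *ₚ-assoc
        ; *-identity = *ₚ-identityˡ , λ f n → trans (*ₚ-comm f 1ₚ n) (*ₚ-identityˡ f n)
        ; distrib = *ₚ-distribˡ-+ₚ , λ f g h n →
            trans (*ₚ-comm (g +ₚ h) f n) (trans (*ₚ-distribˡ-+ₚ f g h n) (+-cong (*ₚ-comm f g n) (*ₚ-comm f h n)))
        }
      ; *-comm = *ₚ-comm
      }
    }

  ∑≤-coefficient : ∀ n (F : ℕ → Series) m → FiniteSum.∑≤ powerSeriesRing n F m ≡ ∑≤ n (λ k → F k m)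
  ∑≤-coefficient zero    F m = refl
  ∑≤-coefficient (suc n) F m = ≡.cong (_+ F (suc n) m) (∑≤-coefficient n F m)

-- Ser as the ring ℤ[[q]][[z]][[a]]

ℤ[[q]] ℤ[[q]][[z]] ℤ[[q]][[z]][[a]] : CommutativeRing 0ℓ 0ℓ
ℤ[[q]]           = PowerSeries.powerSeriesRing ℤₚ.+-*-commutativeRing
ℤ[[q]][[z]]      = PowerSeries.powerSeriesRing ℤ[[q]]
ℤ[[q]][[z]][[a]] = PowerSeries.powerSeriesRing ℤ[[q]][[z]]

module ℤΣ = FiniteSum ℤₚ.+-*-commutativeRing
module ℤ[[q,z,a]] = CommutativeRing ℤ[[q]][[z]][[a]]

sumTo≡∑≤ : ∀ n f → sumTo n f ≡ ℤΣ.∑≤ n f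
sumTo≡∑≤ zero    f = refl
sumTo≡∑≤ (suc n) f = ≡.cong (ℤ._+ f (suc n)) (sumTo≡∑≤ n f)

-- Defs' triple Cauchy product is the product of ℤ[[q]][[z]][[a]], which transfers the ring laws to Ser.
⊗≈*ₚ : ∀ F G → F ⊗ G ℤ[[q,z,a]].≈ F ℤ[[q,z,a]].* G
⊗≈*ₚ F G i j N = ≡.sym (begin
  (F ℤ[[q,z,a]].* G) i j N
    ≡⟨ ≡.cong (λ h → h N) (PowerSeries.∑≤-coefficient ℤ[[q]] i _ j) ⟩
  FiniteSum.∑≤ ℤ[[q]] i (λ i₁ → (F i₁ *₂ G (i ∸ i₁)) j) N
    ≡⟨ PowerSeries.∑≤-coefficient ℤₚ.+-*-commutativeRing i _ N ⟩
  ℤΣ.∑≤ i (λ i₁ → (F i₁ *₂ G (i ∸ i₁)) j N)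
    ≡⟨ ℤΣ.∑≤-cong i (λ i₁ _ → ≡.trans (PowerSeries.∑≤-coefficient ℤₚ.+-*-commutativeRing j _ N)
                                 (ℤΣ.∑≤-cong j (λ j₁ _ → ≡.sym (sumTo≡∑≤ N _)))) ⟩
  ℤΣ.∑≤ i (λ i₁ → ℤΣ.∑≤ j (λ j₁ → sumTo N (λ n₁ → F i₁ j₁ n₁ ℤ.* G (i ∸ i₁) (j ∸ j₁) (N ∸ n₁))))
    ≡⟨ ℤΣ.∑≤-cong i (λ i₁ _ → ≡.sym (sumTo≡∑≤ j _)) ⟩
  ℤΣ.∑≤ i (λ i₁ → sumTo j (λ j₁ → sumTo N (λ n₁ → F i₁ j₁ n₁ ℤ.* G (i ∸ i₁) (j ∸ j₁) (N ∸ n₁))))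
    ≡⟨ ≡.sym (sumTo≡∑≤ i _) ⟩
  (F ⊗ G) i j N ∎)
  where
  open ≡.≡-Reasoning
  open CommutativeRing ℤ[[q]][[z]] using () renaming (_*_ to _*₂_)

one≈1# : one ℤ[[q,z,a]].≈ ℤ[[q,z,a]].1#
one≈1# zero    zero    zero    = refl
one≈1# zero    zero    (suc N) = refl
one≈1# zero    (suc j) N       = refl
one≈1# (suc i) j       N       = refl

serRing : CommutativeRing 0ℓ 0ℓ
serRing = record
  { Carrier = Ser ; _≈_ = _≈_ ; _+_ = _⊕_ ; _*_ = _⊗_ ; -_ = -_ ; 0# = 0# ; 1# = one
  ; isCommutativeRing = record
    { isRing = record
      { +-isAbelianGroup = +-isAbelianGroup
      ; *-cong = ⊗-cong
      ; *-assoc = ⊗-assoc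
      ; *-identity = ⊗-identityˡ , λ F → trans (⊗-comm F one) (⊗-identityˡ F)
      ; distrib = ⊗-distribˡ-⊕ , λ F G H →
          trans (⊗-comm (G ⊕ H) F) (trans (⊗-distribˡ-⊕ F G H) (+-cong (⊗-comm F G) (⊗-comm F H)))
      }
    ; *-comm = ⊗-comm
    }
  }
  where
  open ℤ[[q,z,a]]
  open SetoidReasoning setoid

  ⊗-cong : ∀ {F F′ G G′} → F ≈ F′ → G ≈ G′ → F ⊗ G ≈ F′ ⊗ G′
  ⊗-cong {F} {F′} {G} {G′} F≈F′ G≈G′ = begin
    F ⊗ G   ≈⟨ ⊗≈*ₚ F G ⟩
    F * G   ≈⟨ *-cong F≈F′ G≈G′ ⟩
    F′ * G′ ≈⟨ ⊗≈*ₚ F′ G′ ⟨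
    F′ ⊗ G′ ∎

  ⊗-assoc : ∀ F G H → (F ⊗ G) ⊗ H ≈ F ⊗ (G ⊗ H)
  ⊗-assoc F G H = begin
    (F ⊗ G) ⊗ H ≈⟨ ⊗≈*ₚ (F ⊗ G) H ⟩
    (F ⊗ G) * H ≈⟨ *-congʳ {H} {F ⊗ G} {F * G} (⊗≈*ₚ F G) ⟩
    (F * G) * H ≈⟨ *-assoc F G H ⟩
    F * (G * H) ≈⟨ *-congˡ {F} {G ⊗ H} {G * H} (⊗≈*ₚ G H) ⟨
    F * (G ⊗ H) ≈⟨ ⊗≈*ₚ F (G ⊗ H) ⟨
    F ⊗ (G ⊗ H) ∎

  ⊗-comm : ∀ F G → F ⊗ G ≈ G ⊗ F
  ⊗-comm F G = trans (⊗≈*ₚ F G) (trans (*-comm F G) (sym (⊗≈*ₚ G F)))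

  ⊗-identityˡ : ∀ F → one ⊗ F ≈ F
  ⊗-identityˡ F = trans (⊗≈*ₚ one F) (trans (*-congʳ {F} {one} {1#} one≈1#) (*-identityˡ F))

  ⊗-distribˡ-⊕ : ∀ F G H → F ⊗ (G ⊕ H) ≈ F ⊗ G ⊕ F ⊗ H
  ⊗-distribˡ-⊕ F G H = trans (⊗≈*ₚ F (G ⊕ H))
    (trans (distribˡ F G H) (+-cong {F * G} {F ⊗ G} {F * H} {F ⊗ H} (sym (⊗≈*ₚ F G)) (sym (⊗≈*ₚ F H))))

open CommutativeRing serRing public
  hiding (Carrier; _+_; _*_; 1#; zero) renaming (refl to ≈-refl)

open import Algebra.Properties.Ring ring using (-‿distribˡ-*; -‿distribʳ-*)
open import Algebra.Properties.AbelianGroup +-abelianGroup using (⁻¹-∙-comm)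
open import Algebra.Solver.CommutativeMonoid *-commutativeMonoid using (_⊜_) renaming (_⊕_ to _·_; solve to ⊗-solve)

⊗-congˡ : ∀ F {G G′} → G ≈ G′ → F ⊗ G ≈ F ⊗ G′
⊗-congˡ F = *-congˡ {F}

⊗-congʳ : ∀ G {F F′} → F ≈ F′ → F ⊗ G ≈ F′ ⊗ G
⊗-congʳ G = *-congʳ {G}

⊕-congˡ : ∀ F {G G′} → G ≈ G′ → F ⊕ G ≈ F ⊕ G′
⊕-congˡ F = +-congˡ {F}

infixl 6 _⊖_
_⊖_ : Ser → Ser → Ser
F ⊖ G = F ⊕ - G

⊕-⊖-cancel : ∀ F G → G ⊕ (F ⊖ G) ≈ F
⊕-⊖-cancel F G i j N = solve 2 (λ x y → y :+ (x :- y) := x) refl (F i j N) (G i j N)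
  where open ℤ-Solver

⊗-distribˡ-⊖ : ∀ F G H → F ⊗ G ⊖ F ⊗ H ≈ F ⊗ (G ⊖ H)
⊗-distribˡ-⊖ F G H = sym (trans (distribˡ F G (- H)) (⊕-congˡ (F ⊗ G) (sym (-‿distribʳ-* F H))))

1+-⊖-1+ : ∀ G H → (one ⊕ G) ⊖ (one ⊕ H) ≈ G ⊖ H
1+-⊖-1+ G H i j N = solve 3 (λ o g h → (o :+ g) :- (o :+ h) := g :- h) refl (one i j N) (G i j N) (H i j N)
  where open ℤ-Solver

sumTo-cong : ∀ n {f g : ℕ → ℤ} → (∀ k → k ≤ n → f k ≡ g k) → sumTo n f ≡ sumTo n g
sumTo-cong zero    f≡g = f≡g 0 z≤n
sumTo-cong (suc n) f≡g = ≡.cong₂ ℤ._+_ (sumTo-cong n (λ k k≤n → f≡g k (ℕₚ.m≤n⇒m≤1+n k≤n))) (f≡g (suc n) ℕₚ.≤-refl)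

sumTo-zero : ∀ n {f} → (∀ k → k ≤ n → f k ≡ 0ℤ) → sumTo n f ≡ 0ℤ
sumTo-zero n {f} f≡0 = ≡.trans (sumTo≡∑≤ n f) (ℤΣ.∑≤-zero n f≡0)

sumTo-distrib-+ : ∀ n f g → sumTo n (λ k → f k ℤ.+ g k) ≡ sumTo n f ℤ.+ sumTo n g
sumTo-distrib-+ n f g = ≡.trans (sumTo≡∑≤ n _)
  (≡.trans (ℤΣ.∑≤-distrib-+ n f g) (≡.sym (≡.cong₂ ℤ._+_ (sumTo≡∑≤ n f) (sumTo≡∑≤ n g))))

*-distribˡ-sumTo : ∀ n x f → x ℤ.* sumTo n f ≡ sumTo n (λ k → x ℤ.* f k)
*-distribˡ-sumTo n x f = ≡.trans (≡.cong (x ℤ.*_) (sumTo≡∑≤ n f))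
  (≡.trans (ℤΣ.*-distribˡ-∑≤ n x f) (≡.sym (sumTo≡∑≤ n _)))

-‿distrib-sumTo : ∀ n f → ℤ.- sumTo n f ≡ sumTo n (λ k → ℤ.- f k)
-‿distrib-sumTo n f = ≡.trans (≡.cong ℤ.-_ (sumTo≡∑≤ n f))
  (≡.trans (ℤΣ.-‿distrib-∑≤ n f) (≡.sym (sumTo≡∑≤ n _)))

sumTo-extend : ∀ m n {f} → m ≤ n → (∀ k → m < k → k ≤ n → f k ≡ 0ℤ) → sumTo n f ≡ sumTo m f
sumTo-extend m n {f} m≤n f≡0 = ≡.trans (sumTo≡∑≤ n f)
  (≡.trans (ℤΣ.∑≤-extend m n m≤n f≡0) (≡.sym (sumTo≡∑≤ m f)))

sumTo-unfoldˡ : ∀ n f → sumTo (suc n) f ≡ f 0 ℤ.+ sumTo n (f ∘ suc)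
sumTo-unfoldˡ n f = ≡.trans (sumTo≡∑≤ (suc n) f)
  (≡.trans (ℤΣ.∑≤-unfoldˡ n f) (≡.cong (λ s → f 0 ℤ.+ s) (≡.sym (sumTo≡∑≤ n _))))

sumTo-comm : ∀ m n (φ : ℕ → ℕ → ℤ) → sumTo m (λ a → sumTo n (φ a)) ≡ sumTo n (λ b → sumTo m (λ a → φ a b))
sumTo-comm m n φ = begin
  sumTo m (λ a → sumTo n (φ a))            ≡⟨ sumTo≡∑≤ m _ ⟩
  ℤΣ.∑≤ m (λ a → sumTo n (φ a))            ≡⟨ ℤΣ.∑≤-cong m (λ a _ → sumTo≡∑≤ n _) ⟩
  ℤΣ.∑≤ m (λ a → ℤΣ.∑≤ n (φ a))            ≡⟨ ℤΣ.∑≤-comm m n φ ⟩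
  ℤΣ.∑≤ n (λ b → ℤΣ.∑≤ m (λ a → φ a b))    ≡⟨ ℤΣ.∑≤-cong n (λ b _ → sumTo≡∑≤ m _) ⟨
  ℤΣ.∑≤ n (λ b → sumTo m (λ a → φ a b))    ≡⟨ sumTo≡∑≤ n _ ⟨
  sumTo n (λ b → sumTo m (λ a → φ a b))    ∎
  where open ≡.≡-Reasoning

infixr 8 [_≤_]_
[_≤_]_ : ℕ → ℕ → ℤ → ℤ
[ zero  ≤ n     ] x = x
[ suc m ≤ zero  ] x = 0ℤ
[ suc m ≤ suc n ] x = [ m ≤ n ] x

[≤]-true : ∀ {m n} x → m ≤ n → [ m ≤ n ] x ≡ x
[≤]-true {zero}          x _         = refl
[≤]-true {suc m} {suc n} x (s≤s m≤n) = [≤]-true x m≤n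

[≤]-false : ∀ {m n} x → n < m → [ m ≤ n ] x ≡ 0ℤ
[≤]-false {suc m} {zero}  x _         = refl
[≤]-false {suc m} {suc n} x (s≤s n<m) = [≤]-false x n<m

[≤]-cong : ∀ m n {x y} → (m ≤ n → x ≡ y) → [ m ≤ n ] x ≡ [ m ≤ n ] y
[≤]-cong m n {x} {y} x≡y with m ℕ.≤? n
... | yes m≤n = ≡.trans ([≤]-true x m≤n) (≡.trans (x≡y m≤n) (≡.sym ([≤]-true y m≤n)))
... | no  m≰n = ≡.trans ([≤]-false x (ℕₚ.≰⇒> m≰n)) (≡.sym ([≤]-false y (ℕₚ.≰⇒> m≰n)))

[≤]-zero : ∀ m n {x} → (m ≤ n → x ≡ 0ℤ) → [ m ≤ n ] x ≡ 0ℤ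
[≤]-zero m n {x} x≡0 with m ℕ.≤? n
... | yes m≤n = ≡.trans ([≤]-true x m≤n) (x≡0 m≤n)
... | no  m≰n = [≤]-false x (ℕₚ.≰⇒> m≰n)

[≤]-+ : ∀ m n x y → [ m ≤ n ] (x ℤ.+ y) ≡ [ m ≤ n ] x ℤ.+ [ m ≤ n ] y
[≤]-+ zero    n       x y = refl
[≤]-+ (suc m) zero    x y = refl
[≤]-+ (suc m) (suc n) x y = [≤]-+ m n x y

[≤]-* : ∀ m n c x → [ m ≤ n ] (c ℤ.* x) ≡ c ℤ.* [ m ≤ n ] x
[≤]-* zero    n       c x = refl
[≤]-* (suc m) zero    c x = ≡.sym (ℤₚ.*-zeroʳ c)
[≤]-* (suc m) (suc n) c x = [≤]-* m n c x

[≤]-sumTo : ∀ m n k f → [ m ≤ n ] sumTo k f ≡ sumTo k (λ x → [ m ≤ n ] f x)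
[≤]-sumTo m n zero    f = refl
[≤]-sumTo m n (suc k) f = ≡.trans ([≤]-+ m n _ _) (≡.cong (ℤ._+ [ m ≤ n ] f (suc k)) ([≤]-sumTo m n k f))

[≤]-absorb : ∀ a b N x → a ≤ b → [ a ≤ N ] [ b ≤ N ] x ≡ [ b ≤ N ] x
[≤]-absorb a b N x a≤b with a ℕ.≤? N
... | yes a≤N = [≤]-true _ a≤N
... | no  a≰N = ≡.trans ([≤]-false _ (ℕₚ.≰⇒> a≰N)) (≡.sym ([≤]-false x (ℕₚ.<-≤-trans (ℕₚ.≰⇒> a≰N) a≤b)))

[≤]-redundant : ∀ m n {x} → (n < m → x ≡ 0ℤ) → [ m ≤ n ] x ≡ x
[≤]-redundant m n {x} x≡0 with m ℕ.≤? n
... | yes m≤n = [≤]-true x m≤n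
... | no  m≰n = ≡.trans ([≤]-false x (ℕₚ.≰⇒> m≰n)) (≡.sym (x≡0 (ℕₚ.≰⇒> m≰n)))

sumTo-single : ∀ n m {f} → (∀ k → k ≢ m → f k ≡ 0ℤ) → sumTo n f ≡ [ m ≤ n ] f m
sumTo-single n m {f} f≡0 with m ℕ.≤? n
... | yes m≤n = ≡.trans (≡.trans (sumTo≡∑≤ n f) (ℤΣ.∑≤-single n m m≤n (λ k _ → f≡0 k))) (≡.sym ([≤]-true _ m≤n))
... | no  m≰n = ≡.trans (sumTo-zero n (λ k k≤n → f≡0 k (λ { refl → m≰n k≤n }))) (≡.sym ([≤]-false _ (ℕₚ.≰⇒> m≰n)))

-- (q^ a · φ) N is the coefficient of q^N in q^a φ(q).
infixr 8 q^_·_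
q^_·_ : ℕ → (ℕ → ℤ) → ℕ → ℤ
(q^ a · φ) N = [ a ≤ N ] φ (N ∸ a)

q^·-q^· : ∀ a b φ N → (q^ a · q^ b · φ) N ≡ (q^ (a ℕ.+ b) · φ) N
q^·-q^· zero    b φ N       = refl
q^·-q^· (suc a) b φ zero    = refl
q^·-q^· (suc a) b φ (suc N) = q^·-q^· a b φ N

q^·-cong : ∀ a {φ ψ} → (∀ M → φ M ≡ ψ M) → ∀ N → (q^ a · φ) N ≡ (q^ a · ψ) N
q^·-cong a φ≡ψ N = ≡.cong ([ a ≤ N ]_) (φ≡ψ (N ∸ a))

q^·-exponent : ∀ {a b} φ N → a ≡ b → (q^ a · φ) N ≡ (q^ b · φ) N
q^·-exponent φ N refl = refl

q^·-+ : ∀ a φ ψ N → (q^ a · λ M → φ M ℤ.+ ψ M) N ≡ (q^ a · φ) N ℤ.+ (q^ a · ψ) N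
q^·-+ a φ ψ N = [≤]-+ a N (φ (N ∸ a)) (ψ (N ∸ a))

≟-true : ∀ {m n} → m ≡ n → ⌊ m ℕ.≟ n ⌋ ≡ true
≟-true {m} {n} m≡n = ≡.trans (isYes≗does (m ℕ.≟ n)) (dec-true (m ℕ.≟ n) m≡n)

≟-false : ∀ {m n} → m ≢ n → ⌊ m ℕ.≟ n ⌋ ≡ false
≟-false {m} {n} m≢n = ≡.trans (isYes≗does (m ℕ.≟ n)) (dec-false (m ℕ.≟ n) m≢n)

≟-∸ : ∀ {i α α′} → α ≤ i → ⌊ i ∸ α ℕ.≟ α′ ⌋ ≡ ⌊ i ℕ.≟ α ℕ.+ α′ ⌋
≟-∸ {i} {α} {α′} α≤i with i ∸ α ℕ.≟ α′
... | yes i∸α≡α′ = ≡.sym (≟-true (≡.trans (≡.sym (ℕₚ.m+[n∸m]≡n α≤i)) (≡.cong (α ℕ.+_) i∸α≡α′)))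
... | no  i∸α≢α′ = ≡.sym (≟-false λ i≡α+α′ → i∸α≢α′ (≡.trans (≡.cong (_∸ α) i≡α+α′) (ℕₚ.m+n∸m≡n α α′)))

<⇒≢+ : ∀ {i α} α′ → i < α → i ≢ α ℕ.+ α′
<⇒≢+ {α = α} α′ i<α = ℕₚ.<⇒≢ (ℕₚ.<-≤-trans i<α (ℕₚ.m≤m+n α α′))

mono-diag : ∀ c α β k → mono c α β k α β k ≡ c
mono-diag c α β k rewrite ≟-true {α} refl | ≟-true {β} refl | ≟-true {k} refl = refl

mono-off : ∀ c α β k i j N → i ≢ α ⊎ j ≢ β ⊎ N ≢ k → mono c α β k i j N ≡ 0ℤ
mono-off c α β k i j N (inj₁ i≢α)        rewrite ≟-false i≢α = refl
mono-off c α β k i j N (inj₂ (inj₁ j≢β)) rewrite ≟-false j≢β | ∧-zeroʳ ⌊ i ℕ.≟ α ⌋ = refl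
mono-off c α β k i j N (inj₂ (inj₂ N≢k))
  rewrite ≟-false N≢k | ∧-zeroʳ ⌊ j ℕ.≟ β ⌋ | ∧-zeroʳ ⌊ i ℕ.≟ α ⌋ = refl

mono-∸ : ∀ d α β k α′ β′ k′ {i j N} → α ≤ i → β ≤ j → k ≤ N →
  mono d α′ β′ k′ (i ∸ α) (j ∸ β) (N ∸ k) ≡ mono d (α ℕ.+ α′) (β ℕ.+ β′) (k ℕ.+ k′) i j N
mono-∸ d α β k α′ β′ k′ α≤i β≤j k≤N rewrite ≟-∸ {α′ = α′} α≤i | ≟-∸ {α′ = β′} β≤j | ≟-∸ {α′ = k′} k≤N = refl

*-mono : ∀ c d α β k i j N → c ℤ.* mono d α β k i j N ≡ mono (c ℤ.* d) α β k i j N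
*-mono c d α β k i j N with ⌊ i ℕ.≟ α ⌋ ∧ ⌊ j ℕ.≟ β ⌋ ∧ ⌊ N ℕ.≟ k ⌋
... | true  = refl
... | false = ℤₚ.*-zeroʳ c

mono-neg : ∀ c α β k → mono (ℤ.- c) α β k ≈ - mono c α β k
mono-neg c α β k i j N with ⌊ i ℕ.≟ α ⌋ ∧ ⌊ j ℕ.≟ β ⌋ ∧ ⌊ N ℕ.≟ k ⌋
... | true  = refl
... | false = refl

mono-cong : ∀ {c c′ α α′ β β′ k k′} → c ≡ c′ → α ≡ α′ → β ≡ β′ → k ≡ k′ → mono c α β k ≈ mono c′ α′ β′ k′
mono-cong refl refl refl refl i j N = refl

coeff-mono-⊗ : ∀ c α β k F i j N →
  (mono c α β k ⊗ F) i j N ≡ [ α ≤ i ] [ β ≤ j ] [ k ≤ N ] (c ℤ.* F (i ∸ α) (j ∸ β) (N ∸ k))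
coeff-mono-⊗ c α β k F i j N = begin
  sumTo i (λ i₁ → sumTo j (λ j₁ → sumTo N (λ n₁ → m i₁ j₁ n₁ ℤ.* F (i ∸ i₁) (j ∸ j₁) (N ∸ n₁))))
    ≡⟨ sumTo-single i α (λ i₁ i₁≢α → sumTo-zero j (λ j₁ _ → sumTo-zero N (λ n₁ _ →
         ≡.cong (ℤ._* F (i ∸ i₁) (j ∸ j₁) (N ∸ n₁)) (mono-off c α β k i₁ j₁ n₁ (inj₁ i₁≢α))))) ⟩
  [ α ≤ i ] sumTo j (λ j₁ → sumTo N (λ n₁ → m α j₁ n₁ ℤ.* F (i ∸ α) (j ∸ j₁) (N ∸ n₁)))
    ≡⟨ ≡.cong ([ α ≤ i ]_) (sumTo-single j β (λ j₁ j₁≢β → sumTo-zero N (λ n₁ _ →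
         ≡.cong (ℤ._* F (i ∸ α) (j ∸ j₁) (N ∸ n₁)) (mono-off c α β k α j₁ n₁ (inj₂ (inj₁ j₁≢β)))))) ⟩
  [ α ≤ i ] [ β ≤ j ] sumTo N (λ n₁ → m α β n₁ ℤ.* F (i ∸ α) (j ∸ β) (N ∸ n₁))
    ≡⟨ ≡.cong (λ x → [ α ≤ i ] [ β ≤ j ] x) (sumTo-single N k (λ n₁ n₁≢k →
         ≡.cong (ℤ._* F (i ∸ α) (j ∸ β) (N ∸ n₁)) (mono-off c α β k α β n₁ (inj₂ (inj₂ n₁≢k))))) ⟩
  [ α ≤ i ] [ β ≤ j ] [ k ≤ N ] (m α β k ℤ.* F (i ∸ α) (j ∸ β) (N ∸ k))
    ≡⟨ ≡.cong (λ x → [ α ≤ i ] [ β ≤ j ] [ k ≤ N ] (x ℤ.* F (i ∸ α) (j ∸ β) (N ∸ k))) (mono-diag c α β k) ⟩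
  [ α ≤ i ] [ β ≤ j ] [ k ≤ N ] (c ℤ.* F (i ∸ α) (j ∸ β) (N ∸ k)) ∎
  where
  open ≡.≡-Reasoning
  m = mono c α β k

coeff-⊗-mono : ∀ c α β k F i j N →
  (F ⊗ mono c α β k) i j N ≡ [ α ≤ i ] [ β ≤ j ] [ k ≤ N ] (c ℤ.* F (i ∸ α) (j ∸ β) (N ∸ k))
coeff-⊗-mono c α β k F i j N = ≡.trans (*-comm F (mono c α β k) i j N) (coeff-mono-⊗ c α β k F i j N)

mono-⊗-mono : ∀ c d α β k α′ β′ k′ →
  mono c α β k ⊗ mono d α′ β′ k′ ≈ mono (c ℤ.* d) (α ℕ.+ α′) (β ℕ.+ β′) (k ℕ.+ k′)
mono-⊗-mono c d α β k α′ β′ k′ i j N = begin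
  (mono c α β k ⊗ mono d α′ β′ k′) i j N
    ≡⟨ coeff-mono-⊗ c α β k (mono d α′ β′ k′) i j N ⟩
  [ α ≤ i ] [ β ≤ j ] [ k ≤ N ] (c ℤ.* mono d α′ β′ k′ (i ∸ α) (j ∸ β) (N ∸ k))
    ≡⟨ [≤]-cong α i (λ α≤i → [≤]-cong β j (λ β≤j → [≤]-cong k N (λ k≤N →
         ≡.trans (≡.cong (c ℤ.*_) (mono-∸ d α β k α′ β′ k′ α≤i β≤j k≤N)) (*-mono c d _ _ _ i j N)))) ⟩
  [ α ≤ i ] [ β ≤ j ] [ k ≤ N ] M
    ≡⟨ [≤]-redundant α i (λ i<α → [≤]-zero β j (λ _ → [≤]-zero k N (λ _ → off (inj₁ (<⇒≢+ α′ i<α))))) ⟩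
  [ β ≤ j ] [ k ≤ N ] M
    ≡⟨ [≤]-redundant β j (λ j<β → [≤]-zero k N (λ _ → off (inj₂ (inj₁ (<⇒≢+ β′ j<β))))) ⟩
  [ k ≤ N ] M
    ≡⟨ [≤]-redundant k N (λ N<k → off (inj₂ (inj₂ (<⇒≢+ k′ N<k)))) ⟩
  M ∎
  where
  open ≡.≡-Reasoning
  M = mono (c ℤ.* d) (α ℕ.+ α′) (β ℕ.+ β′) (k ℕ.+ k′) i j N
  off = mono-off (c ℤ.* d) (α ℕ.+ α′) (β ℕ.+ β′) (k ℕ.+ k′) i j N

coeff-⊗-1+mono : ∀ c α β k F i j N →
  (F ⊗ (one ⊕ mono c α β k)) i j N ≡ F i j N ℤ.+ [ α ≤ i ] [ β ≤ j ] [ k ≤ N ] (c ℤ.* F (i ∸ α) (j ∸ β) (N ∸ k))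
coeff-⊗-1+mono c α β k F i j N = ≡.trans (distribˡ F one (mono c α β k) i j N)
  (≡.cong₂ ℤ._+_ (*-identityʳ F i j N) (coeff-⊗-mono c α β k F i j N))

infixl 7 _✶_
_✶_ : (ℕ → ℤ) → (ℕ → ℤ) → ℕ → ℤ
(f ✶ g) N = sumTo N (λ n → f n ℤ.* g (N ∸ n))

✶-q^· : ∀ b f g N → (f ✶ q^ b · g) N ≡ (q^ b · (f ✶ g)) N
✶-q^· zero    f g N       = refl
✶-q^· (suc b) f g zero    = ℤₚ.*-zeroʳ (f 0)
✶-q^· (suc b) f g (suc N) = begin
  sumTo N (λ n → f n ℤ.* (q^ suc b · g) (suc N ∸ n)) ℤ.+ f (suc N) ℤ.* (q^ suc b · g) (suc N ∸ suc N)
    ≡⟨ ≡.cong₂ ℤ._+_ (sumTo-cong N (λ n n≤N → ≡.cong (λ m → f n ℤ.* (q^ suc b · g) m) (ℕₚ.+-∸-assoc 1 n≤N)))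
                     (≡.trans (≡.cong (λ m → f (suc N) ℤ.* (q^ suc b · g) m) (ℕₚ.n∸n≡0 (suc N))) (ℤₚ.*-zeroʳ (f (suc N)))) ⟩
  (f ✶ q^ b · g) N ℤ.+ 0ℤ ≡⟨ ℤₚ.+-identityʳ _ ⟩
  (f ✶ q^ b · g) N        ≡⟨ ✶-q^· b f g N ⟩
  (q^ b · (f ✶ g)) N      ∎
  where open ≡.≡-Reasoning

q^·-✶ : ∀ a b f g N → ((q^ a · f) ✶ (q^ b · g)) N ≡ (q^ (a ℕ.+ b) · (f ✶ g)) N
q^·-✶ zero    b f g N       = ✶-q^· b f g N
q^·-✶ (suc a) b f g zero    = refl
q^·-✶ (suc a) b f g (suc N) = ≡.trans (sumTo-unfoldˡ N _) (≡.trans (ℤₚ.+-identityˡ _) (q^·-✶ a b f g N))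

-- dilate u v F is F(a q^u, z q^v, q).
dilate : ℕ → ℕ → Ser → Ser
dilate u v F i j = q^ (u ℕ.* i ℕ.+ v ℕ.* j) · F i j

dilate-⊗ : ∀ u v F G → dilate u v (F ⊗ G) ≈ dilate u v F ⊗ dilate u v G
dilate-⊗ u v F G i j N = ≡.sym (begin
  sumTo i (λ i₁ → sumTo j (λ j₁ → (q^ e i₁ j₁ · F i₁ j₁ ✶ q^ e (i ∸ i₁) (j ∸ j₁) · G (i ∸ i₁) (j ∸ j₁)) N))
    ≡⟨ sumTo-cong i (λ i₁ i₁≤i → sumTo-cong j (λ j₁ j₁≤j →
         ≡.trans (q^·-✶ (e i₁ j₁) (e (i ∸ i₁) (j ∸ j₁)) (F i₁ j₁) (G (i ∸ i₁) (j ∸ j₁)) N)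
                 (q^·-exponent (F i₁ j₁ ✶ G (i ∸ i₁) (j ∸ j₁)) N (exponent-split i₁≤i j₁≤j)))) ⟩
  sumTo i (λ i₁ → sumTo j (λ j₁ → (q^ e i j · (F i₁ j₁ ✶ G (i ∸ i₁) (j ∸ j₁))) N))
    ≡⟨ sumTo-cong i (λ i₁ _ → ≡.sym ([≤]-sumTo (e i j) N j _)) ⟩
  sumTo i (λ i₁ → [ e i j ≤ N ] sumTo j (λ j₁ → (F i₁ j₁ ✶ G (i ∸ i₁) (j ∸ j₁)) (N ∸ e i j)))
    ≡⟨ ≡.sym ([≤]-sumTo (e i j) N i _) ⟩
  dilate u v (F ⊗ G) i j N ∎)
  where
  open ≡.≡-Reasoning
  e : ℕ → ℕ → ℕ
  e i j = u ℕ.* i ℕ.+ v ℕ.* j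
  exponent-split : ∀ {i j i₁ j₁} → i₁ ≤ i → j₁ ≤ j → e i₁ j₁ ℕ.+ e (i ∸ i₁) (j ∸ j₁) ≡ e i j
  exponent-split {i} {j} {i₁} {j₁} i₁≤i j₁≤j = ≡.trans (regroup u v i₁ (i ∸ i₁) j₁ (j ∸ j₁))
    (≡.cong₂ (λ x y → u ℕ.* x ℕ.+ v ℕ.* y) (ℕₚ.m+[n∸m]≡n i₁≤i) (ℕₚ.m+[n∸m]≡n j₁≤j))
    where
    open +-*-Solver
    regroup : ∀ u v a b c d → (u ℕ.* a ℕ.+ v ℕ.* c) ℕ.+ (u ℕ.* b ℕ.+ v ℕ.* d) ≡ u ℕ.* (a ℕ.+ b) ℕ.+ v ℕ.* (c ℕ.+ d)
    regroup = solve 6 (λ u v a b c d → (u :* a :+ v :* c) :+ (u :* b :+ v :* d) := u :* (a :+ b) :+ v :* (c :+ d)) refl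

dilate-⊕ : ∀ u v F G → dilate u v (F ⊕ G) ≈ dilate u v F ⊕ dilate u v G
dilate-⊕ u v F G i j N = [≤]-+ (u ℕ.* i ℕ.+ v ℕ.* j) N _ _

dilate-cong : ∀ u v {F G} → F ≈ G → dilate u v F ≈ dilate u v G
dilate-cong u v F≈G i j = q^·-cong (u ℕ.* i ℕ.+ v ℕ.* j) (F≈G i j)

dilate-one : ∀ u v → dilate u v one ≈ one
dilate-one u v zero    zero    N rewrite ℕₚ.*-zeroʳ u | ℕₚ.*-zeroʳ v = refl
dilate-one u v zero    (suc j) N = [≤]-zero (u ℕ.* 0 ℕ.+ v ℕ.* suc j) N (λ _ → refl)
dilate-one u v (suc i) j       N = [≤]-zero (u ℕ.* suc i ℕ.+ v ℕ.* j) N (λ _ → refl)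

dilate-mono : ∀ u v c α β k → dilate u v (mono c α β k) ≈ mono c α β ((u ℕ.* α ℕ.+ v ℕ.* β) ℕ.+ k)
dilate-mono u v c α β k i j N = by-cases i j (i ℕ.≟ α) (j ℕ.≟ β)
  where
  e = u ℕ.* α ℕ.+ v ℕ.* β
  both-zero : ∀ i j → i ≢ α ⊎ j ≢ β → dilate u v (mono c α β k) i j N ≡ mono c α β (e ℕ.+ k) i j N
  both-zero i j off = ≡.trans ([≤]-zero (u ℕ.* i ℕ.+ v ℕ.* j) N (λ _ → mono-off c α β k i j _ (Data.Sum.map₂ inj₁ off)))
                              (≡.sym (mono-off c α β (e ℕ.+ k) i j N (Data.Sum.map₂ inj₁ off)))
  by-cases : ∀ i j → Dec (i ≡ α) → Dec (j ≡ β) → dilate u v (mono c α β k) i j N ≡ mono c α β (e ℕ.+ k) i j N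
  by-cases .α .β (yes refl) (yes refl) = ≡.trans
    ([≤]-cong e N (λ e≤N → mono-∸ c 0 0 e α β k {α} {β} {N} z≤n z≤n e≤N))
    ([≤]-redundant e N (λ N<e → mono-off c α β (e ℕ.+ k) α β N (inj₂ (inj₂ (<⇒≢+ k N<e)))))
  by-cases i j (no i≢α) _        = both-zero i j (inj₁ i≢α)
  by-cases i j (yes _)  (no j≢β) = both-zero i j (inj₂ j≢β)

dilate-1+mono : ∀ u v c α β k → dilate u v (one ⊕ mono c α β k) ≈ one ⊕ mono c α β ((u ℕ.* α ℕ.+ v ℕ.* β) ℕ.+ k)
dilate-1+mono u v c α β k = trans (dilate-⊕ u v one (mono c α β k)) (+-cong (dilate-one u v) (dilate-mono u v c α β k))

dilate-dilate : ∀ u v u′ v′ F → dilate u v (dilate u′ v′ F) ≈ dilate (u ℕ.+ u′) (v ℕ.+ v′) F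
dilate-dilate u v u′ v′ F i j N =
  ≡.trans (q^·-q^· (u ℕ.* i ℕ.+ v ℕ.* j) (u′ ℕ.* i ℕ.+ v′ ℕ.* j) (F i j) N) (q^·-exponent (F i j) N (regroup u v u′ v′ i j))
  where
  open +-*-Solver
  regroup : ∀ u v u′ v′ i j → (u ℕ.* i ℕ.+ v ℕ.* j) ℕ.+ (u′ ℕ.* i ℕ.+ v′ ℕ.* j) ≡ (u ℕ.+ u′) ℕ.* i ℕ.+ (v ℕ.+ v′) ℕ.* j
  regroup = solve 6 (λ u v u′ v′ i j → (u :* i :+ v :* j) :+ (u′ :* i :+ v′ :* j) := (u :+ u′) :* i :+ (v :+ v′) :* j) refl

infix 4 q^_∣_
q^_∣_ : ℕ → Ser → Set
q^ n ∣ F = ∀ i j N → N < n → F i j N ≡ 0ℤ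

q^∣-mono : ∀ c α β k → q^ k ∣ mono c α β k
q^∣-mono c α β k i j N N<k = mono-off c α β k i j N (inj₂ (inj₂ (ℕₚ.<⇒≢ N<k)))

q^∣-⊗ʳ : ∀ n {F} G → q^ n ∣ F → q^ n ∣ F ⊗ G
q^∣-⊗ʳ n {F} G q^n∣F i j N N<n = sumTo-zero i (λ i₁ _ → sumTo-zero j (λ j₁ _ → sumTo-zero N (λ n₁ n₁≤N →
  ≡.cong (ℤ._* G (i ∸ i₁) (j ∸ j₁) (N ∸ n₁)) (q^n∣F i₁ j₁ n₁ (ℕₚ.≤-<-trans n₁≤N N<n)))))

q^∣-⊗ˡ : ∀ n F {G} → q^ n ∣ G → q^ n ∣ F ⊗ G
q^∣-⊗ˡ n F {G} q^n∣G i j N N<n = ≡.trans (*-comm F G i j N) (q^∣-⊗ʳ n F q^n∣G i j N N<n)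

record AgreeUpTo (N : ℕ) (F G : Ser) : Set where
  constructor agree
  field coeff-≡ : ∀ i j M → M ≤ N → F i j M ≡ G i j M
open AgreeUpTo

agreeUpTo-setoid : ℕ → Setoid 0ℓ 0ℓ
agreeUpTo-setoid N = record
  { Carrier = Ser
  ; _≈_ = AgreeUpTo N
  ; isEquivalence = record
    { refl  = agree λ _ _ _ _ → refl
    ; sym   = λ F≈G → agree λ i j M M≤N → ≡.sym (coeff-≡ F≈G i j M M≤N)
    ; trans = λ F≈G G≈H → agree λ i j M M≤N → ≡.trans (coeff-≡ F≈G i j M M≤N) (coeff-≡ G≈H i j M M≤N)
    }
  }

≈⇒agreeUpTo : ∀ N {F G} → F ≈ G → AgreeUpTo N F G
≈⇒agreeUpTo N F≈G = agree λ i j M _ → F≈G i j M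

agreeUpTo-all : ∀ {F G} → (∀ N → AgreeUpTo N F G) → F ≈ G
agreeUpTo-all F≈G i j N = coeff-≡ (F≈G N) i j N ℕₚ.≤-refl

agreeUpTo-⊗ : ∀ {N F F′ G G′} → AgreeUpTo N F F′ → AgreeUpTo N G G′ → AgreeUpTo N (F ⊗ G) (F′ ⊗ G′)
agreeUpTo-⊗ F≈F′ G≈G′ = agree λ i j M M≤N → sumTo-cong i (λ i₁ _ → sumTo-cong j (λ j₁ _ → sumTo-cong M (λ n₁ n₁≤M →
  ≡.cong₂ ℤ._*_ (coeff-≡ F≈F′ _ _ _ (ℕₚ.≤-trans n₁≤M M≤N)) (coeff-≡ G≈G′ _ _ _ (ℕₚ.≤-trans (ℕₚ.m∸n≤m M n₁) M≤N)))))

agreeUpTo-dilate : ∀ {N} u v {F G} → AgreeUpTo N F G → AgreeUpTo N (dilate u v F) (dilate u v G)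
agreeUpTo-dilate u v F≈G = agree λ i j M M≤N → let e = u ℕ.* i ℕ.+ v ℕ.* j in
  ≡.cong ([ e ≤ M ]_) (coeff-≡ F≈G i j (M ∸ e) (ℕₚ.≤-trans (ℕₚ.m∸n≤m M e) M≤N))

sumQ-cong : ∀ {F G} → (∀ n → F n ≈ G n) → sumQ F ≈ sumQ G
sumQ-cong F≈G i j N = sumTo-cong N (λ n _ → F≈G n i j N)

sumQ-⊖ : ∀ F G → sumQ F ⊖ sumQ G ≈ sumQ (λ n → F n ⊖ G n)
sumQ-⊖ F G i j N = ≡.sym (≡.trans (sumTo-distrib-+ N _ _) (≡.cong (λ x → sumQ F i j N ℤ.+ x) (≡.sym (-‿distrib-sumTo N _))))

sumQ-unfoldˡ : ∀ F → (∀ n → q^ n ∣ F n) → sumQ F ≈ F 0 ⊕ sumQ (F ∘ suc)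
sumQ-unfoldˡ F q^n∣F i j zero    = ≡.sym (≡.trans (≡.cong (λ x → F 0 i j 0 ℤ.+ x) (q^n∣F 1 i j 0 (s≤s z≤n))) (ℤₚ.+-identityʳ _))
sumQ-unfoldˡ F q^n∣F i j (suc N) = ≡.trans (sumTo-unfoldˡ N _)
  (≡.cong (λ x → F 0 i j (suc N) ℤ.+ x) (≡.sym (sumTo-extend N (suc N) (ℕₚ.n≤1+n N) (λ k N<k _ → q^n∣F (suc k) i j (suc N) (s≤s N<k)))))

⊗-sumQ : ∀ G F → (∀ n → q^ n ∣ F n) → G ⊗ sumQ F ≈ sumQ (λ n → G ⊗ F n)
⊗-sumQ G F q^n∣F i j N = begin
  sumTo i (λ i₁ → sumTo j (λ j₁ → sumTo N (λ n₁ → G i₁ j₁ n₁ ℤ.* sumTo (N ∸ n₁) (λ n → F n (i ∸ i₁) (j ∸ j₁) (N ∸ n₁)))))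
    ≡⟨ sumTo-cong i (λ i₁ _ → sumTo-cong j (λ j₁ _ → sumTo-cong N (λ n₁ _ →
         ≡.trans (≡.cong (G i₁ j₁ n₁ ℤ.*_) (≡.sym (sumTo-extend (N ∸ n₁) N (ℕₚ.m∸n≤m N n₁) (λ k N-n₁<k _ → q^n∣F k _ _ _ N-n₁<k))))
                 (*-distribˡ-sumTo N (G i₁ j₁ n₁) _)))) ⟩
  sumTo i (λ i₁ → sumTo j (λ j₁ → sumTo N (λ n₁ → sumTo N (λ n → term n i₁ j₁ n₁))))
    ≡⟨ sumTo-cong i (λ i₁ _ → sumTo-cong j (λ j₁ _ → sumTo-comm N N _)) ⟩
  sumTo i (λ i₁ → sumTo j (λ j₁ → sumTo N (λ n → sumTo N (term n i₁ j₁))))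
    ≡⟨ sumTo-cong i (λ i₁ _ → sumTo-comm j N _) ⟩
  sumTo i (λ i₁ → sumTo N (λ n → sumTo j (λ j₁ → sumTo N (term n i₁ j₁))))
    ≡⟨ sumTo-comm i N _ ⟩
  sumTo N (λ n → sumTo i (λ i₁ → sumTo j (λ j₁ → sumTo N (term n i₁ j₁)))) ∎
  where
  open ≡.≡-Reasoning
  term : ℕ → ℕ → ℕ → ℕ → ℤ
  term n i₁ j₁ n₁ = G i₁ j₁ n₁ ℤ.* F n (i ∸ i₁) (j ∸ j₁) (N ∸ n₁)

dilate-sumQ : ∀ u v F → (∀ n → q^ n ∣ F n) → dilate u v (sumQ F) ≈ sumQ (dilate u v ∘ F)
dilate-sumQ u v F q^n∣F i j N = ≡.trans
  (≡.cong ([ e ≤ N ]_) (≡.sym (sumTo-extend (N ∸ e) N (ℕₚ.m∸n≤m N e) (λ k N-e<k _ → q^n∣F k i j (N ∸ e) N-e<k))))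
  ([≤]-sumTo e N N _)
  where e = u ℕ.* i ℕ.+ v ℕ.* j

sumQ-reindex : ∀ T C U → (∀ n → q^ n ∣ T n) → (∀ n → q^ n ∣ U n) →
  T 0 ≈ 0# → (∀ m → T (suc m) ≈ C ⊗ U m) → sumQ T ≈ C ⊗ sumQ U
sumQ-reindex T C U q^n∣T q^n∣U T0≈0 T[1+m]≈CU = begin
  sumQ T                        ≈⟨ sumQ-unfoldˡ T q^n∣T ⟩
  T 0 ⊕ sumQ (T ∘ suc)          ≈⟨ +-cong T0≈0 (sumQ-cong T[1+m]≈CU) ⟩
  0# ⊕ sumQ (λ m → C ⊗ U m)     ≈⟨ +-identityˡ _ ⟩
  sumQ (λ m → C ⊗ U m)          ≈⟨ ⊗-sumQ C U q^n∣U ⟨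
  C ⊗ sumQ U                    ∎
  where open SetoidReasoning setoid

prod1to-cong : ∀ n {F G} → (∀ k → F (suc k) ≈ G (suc k)) → prod1to n F ≈ prod1to n G
prod1to-cong zero    F≈G = ≈-refl
prod1to-cong (suc n) F≈G = *-cong (prod1to-cong n F≈G) (F≈G n)

prod1to-unfoldˡ : ∀ n F → prod1to (suc n) F ≈ F 1 ⊗ prod1to n (F ∘ suc)
prod1to-unfoldˡ zero    F = *-comm one (F 1)
prod1to-unfoldˡ (suc n) F = trans (⊗-congʳ (F (suc (suc n))) (prod1to-unfoldˡ n F))
                                  (*-assoc (F 1) (prod1to n (F ∘ suc)) (F (suc (suc n))))

prod1to-⊗ : ∀ n F G → prod1to n (λ k → F k ⊗ G k) ≈ prod1to n F ⊗ prod1to n G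
prod1to-⊗ zero    F G = sym (*-identityˡ one)
prod1to-⊗ (suc n) F G = trans (⊗-congʳ (F (suc n) ⊗ G (suc n)) (prod1to-⊗ n F G))
                              (interchange (prod1to n F) (prod1to n G) (F (suc n)) (G (suc n)))
  where open import Algebra.Properties.CommutativeSemigroup *-commutativeSemigroup using (interchange)

prod1to-one : ∀ n {F} → (∀ k → F (suc k) ≈ one) → prod1to n F ≈ one
prod1to-one zero    F≈1 = ≈-refl
prod1to-one (suc n) F≈1 = trans (*-cong (prod1to-one n F≈1) (F≈1 n)) (*-identityˡ one)

record IsMultiplicative (π : Ser → Ser) : Set where
  field
    π-cong : ∀ {F G} → F ≈ G → π F ≈ π G
    π-⊗    : ∀ F G → π (F ⊗ G) ≈ π F ⊗ π G
    π-one  : π one ≈ one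

  π-prod1to : ∀ n F → π (prod1to n F) ≈ prod1to n (π ∘ F)
  π-prod1to zero    F = π-one
  π-prod1to (suc n) F = trans (π-⊗ (prod1to n F) (F (suc n))) (⊗-congʳ (π (F (suc n))) (π-prod1to n F))

  π-inverse : ∀ {F G} → F ⊗ G ≈ one → π F ⊗ π G ≈ one
  π-inverse {F} {G} F⊗G≈1 = trans (sym (π-⊗ F G)) (trans (π-cong F⊗G≈1) π-one)

  Fixed : Ser → Set
  Fixed F = π F ≈ F

  fixed-⊗ : ∀ {F G} → Fixed F → Fixed G → Fixed (F ⊗ G)
  fixed-⊗ {F} {G} πF≈F πG≈G = trans (π-⊗ F G) (*-cong πF≈F πG≈G)

  fixed-prod1to : ∀ n F → (∀ k → Fixed (F (suc k))) → Fixed (prod1to n F)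
  fixed-prod1to n F fixed = trans (π-prod1to n F) (prod1to-cong n fixed)

dilate-isMultiplicative : ∀ u v → IsMultiplicative (dilate u v)
dilate-isMultiplicative u v = record { π-cong = dilate-cong u v ; π-⊗ = dilate-⊗ u v ; π-one = dilate-one u v }

inverse-unique : ∀ {F F′ G} → F ⊗ G ≈ one → F′ ⊗ G ≈ one → F ≈ F′
inverse-unique {F} {F′} {G} F⊗G≈1 F′⊗G≈1 = begin
  F              ≈⟨ *-identityʳ F ⟨
  F ⊗ one        ≈⟨ ⊗-congˡ F F′⊗G≈1 ⟨
  F ⊗ (F′ ⊗ G)   ≈⟨ x∙yz≈y∙xz F F′ G ⟩
  F′ ⊗ (F ⊗ G)   ≈⟨ ⊗-congˡ F′ F⊗G≈1 ⟩
  F′ ⊗ one       ≈⟨ *-identityʳ F′ ⟩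
  F′             ∎
  where
  open SetoidReasoning setoid
  open import Algebra.Properties.CommutativeSemigroup *-commutativeSemigroup using (x∙yz≈y∙xz)

poch-suc-agree : ∀ s α β {N} n → N ≤ n → AgreeUpTo N (poch s α β (suc n)) (poch s α β n)
poch-suc-agree s α β n N≤n = agree λ i j M M≤N → ≡.trans
  (distribˡ (poch s α β n) one (mono s α β (suc n)) i j M)
  (≡.trans (≡.cong₂ ℤ._+_ (*-identityʳ (poch s α β n) i j M)
                          (q^∣-⊗ˡ (suc n) (poch s α β n) (q^∣-mono s α β (suc n)) i j M (s≤s (ℕₚ.≤-trans M≤N N≤n))))
           (ℤₚ.+-identityʳ _))

pochInf-agree : ∀ s α β N → AgreeUpTo N (pochInf s α β) (poch s α β N)
pochInf-agree s α β N = agree λ i j M M≤N → stable M≤N i j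
  where
  stable : ∀ {M n} → M ≤ n → ∀ i j → poch s α β M i j M ≡ poch s α β n i j M
  stable {M} {n} M≤n i j with ℕₚ.m≤n⇒m<n∨m≡n M≤n
  ... | inj₂ refl          = refl
  ... | inj₁ (s≤s M≤n-1) = ≡.trans (stable M≤n-1 i j) (≡.sym (coeff-≡ (poch-suc-agree s α β _ M≤n-1) i j M ℕₚ.≤-refl))

dilate-poch : ∀ s α β u v n → u ℕ.* α ℕ.+ v ℕ.* β ≡ 1 →
  dilate u v (poch s α β n) ≈ prod1to n (λ k → one ⊕ mono s α β (suc k))
dilate-poch s α β u v n uα+vβ≡1 = trans (IsMultiplicative.π-prod1to (dilate-isMultiplicative u v) n _) (prod1to-cong n λ k →
  trans (dilate-1+mono u v s α β (suc k)) (+-congˡ {one} (mono-cong refl refl refl (≡.cong (ℕ._+ suc k) uα+vβ≡1))))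

-- (x;q)_∞ = (1 - x)(xq;q)_∞ for x = -s a^α z^β q; the hypothesis on u, v makes the dilation send x to xq.
pochInf-unfold : ∀ s α β u v → u ℕ.* α ℕ.+ v ℕ.* β ≡ 1 →
  pochInf s α β ≈ (one ⊕ mono s α β 1) ⊗ dilate u v (pochInf s α β)
pochInf-unfold s α β u v uα+vβ≡1 = agreeUpTo-all λ N → let open SetoidReasoning (agreeUpTo-setoid N) in begin
  pochInf s α β                                     ≈⟨ pochInf-agree s α β N ⟩
  poch s α β N                                      ≈⟨ poch-suc-agree s α β N ℕₚ.≤-refl ⟨
  poch s α β (suc N)                                ≈⟨ ≈⇒agreeUpTo N (prod1to-unfoldˡ N _) ⟩
  Y ⊗ prod1to N (λ k → one ⊕ mono s α β (suc k))    ≈⟨ ≈⇒agreeUpTo N (⊗-congˡ Y (dilate-poch s α β u v N uα+vβ≡1)) ⟨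
  Y ⊗ dilate u v (poch s α β N)
    ≈⟨ agreeUpTo-⊗ (≈⇒agreeUpTo N (≈-refl {Y})) (agreeUpTo-dilate u v (pochInf-agree s α β N)) ⟨
  Y ⊗ dilate u v (pochInf s α β)                    ∎
  where Y = one ⊕ mono s α β 1

module GeometricSeries (s : ℤ) (α β k : ℕ) where
  open FiniteSum serRing using (∑≤)

  x : Ser
  x = mono s α β (suc k)

  power : ℕ → Ser
  power m = mono ((ℤ.- s) ℤ.^ m) (α ℕ.* m) (β ℕ.* m) (suc k ℕ.* m)

  power-zero : power 0 ≈ one
  power-zero = mono-cong refl (ℕₚ.*-zeroʳ α) (ℕₚ.*-zeroʳ β) (ℕₚ.*-zeroʳ (suc k))

  power-suc : ∀ m → power m ⊗ x ≈ - power (suc m)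
  power-suc m = begin
    power m ⊗ x
      ≈⟨ mono-⊗-mono _ s (α ℕ.* m) (β ℕ.* m) (suc k ℕ.* m) α β (suc k) ⟩
    mono ((ℤ.- s) ℤ.^ m ℤ.* s) (α ℕ.* m ℕ.+ α) (β ℕ.* m ℕ.+ β) (suc k ℕ.* m ℕ.+ suc k)
      ≈⟨ mono-cong (ℤ-step m) (ℕ-step α) (ℕ-step β) (ℕ-step (suc k)) ⟩
    mono (ℤ.- ((ℤ.- s) ℤ.^ suc m)) (α ℕ.* suc m) (β ℕ.* suc m) (suc k ℕ.* suc m)
      ≈⟨ mono-neg _ _ _ _ ⟩
    - power (suc m) ∎
    where
    open SetoidReasoning setoid
    ℕ-step : ∀ γ → γ ℕ.* m ℕ.+ γ ≡ γ ℕ.* suc m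
    ℕ-step γ = ≡.trans (ℕₚ.+-comm (γ ℕ.* m) γ) (≡.sym (ℕₚ.*-suc γ m))
    ℤ-step : ∀ m → (ℤ.- s) ℤ.^ m ℤ.* s ≡ ℤ.- ((ℤ.- s) ℤ.^ suc m)
    ℤ-step m = ≡.trans (ℤₚ.*-comm _ s)
      (≡.trans (≡.cong (ℤ._* ((ℤ.- s) ℤ.^ m)) (≡.sym (ℤₚ.neg-involutive s))) (≡.sym (ℤₚ.neg-distribˡ-* (ℤ.- s) _)))

  partial-telescopes : ∀ n → ∑≤ n power ⊗ (one ⊕ x) ≈ one ⊖ power (suc n)
  partial-telescopes zero = begin
    power 0 ⊗ (one ⊕ x)             ≈⟨ distribˡ (power 0) one x ⟩
    power 0 ⊗ one ⊕ power 0 ⊗ x     ≈⟨ +-cong (trans (*-identityʳ (power 0)) power-zero) (power-suc 0) ⟩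
    one ⊖ power 1                   ∎
    where open SetoidReasoning setoid
  partial-telescopes (suc n) = begin
    (∑≤ n power ⊕ power (suc n)) ⊗ (one ⊕ x)
      ≈⟨ distribʳ (one ⊕ x) (∑≤ n power) (power (suc n)) ⟩
    ∑≤ n power ⊗ (one ⊕ x) ⊕ power (suc n) ⊗ (one ⊕ x)
      ≈⟨ +-cong (partial-telescopes n) (trans (distribˡ (power (suc n)) one x)
                                              (+-cong (*-identityʳ (power (suc n))) (power-suc (suc n)))) ⟩
    (one ⊖ power (suc n)) ⊕ (power (suc n) ⊖ power (suc (suc n)))
      ≈⟨ cancel one (power (suc n)) (- power (suc (suc n))) ⟩
    one ⊖ power (suc (suc n)) ∎
    where
    open SetoidReasoning setoid
    cancel : ∀ a b c → (a ⊖ b) ⊕ (b ⊕ c) ≈ a ⊕ c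
    cancel a b c i j N = solve 3 (λ a b c → (a :- b) :+ (b :+ c) := a :+ c) refl (a i j N) (b i j N) (c i j N)
      where open ℤ-Solver

  geomInv-agree : ∀ N → AgreeUpTo N (geomInv s α β (suc k)) (∑≤ N power)
  geomInv-agree N = agree λ i j M M≤N → ≡.sym (≡.trans (∑≤-serRing N power i j M)
    (sumTo-extend M N M≤N (λ m M<m _ → q^∣-mono _ _ _ _ i j M (ℕₚ.<-≤-trans M<m (ℕₚ.m≤m+n m (k ℕ.* m))))))
    where
    ∑≤-serRing : ∀ n (F : ℕ → Ser) i j N → ∑≤ n F i j N ≡ sumTo n (λ m → F m i j N)
    ∑≤-serRing zero    F i j N = refl
    ∑≤-serRing (suc n) F i j N = ≡.cong (ℤ._+ F (suc n) i j N) (∑≤-serRing n F i j N)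

  geomInv-inverse : geomInv s α β (suc k) ⊗ (one ⊕ x) ≈ one
  geomInv-inverse = agreeUpTo-all λ N → let open SetoidReasoning (agreeUpTo-setoid N) in begin
    geomInv s α β (suc k) ⊗ (one ⊕ x)  ≈⟨ agreeUpTo-⊗ (geomInv-agree N) (≈⇒agreeUpTo N (≈-refl {one ⊕ x})) ⟩
    ∑≤ N power ⊗ (one ⊕ x)             ≈⟨ ≈⇒agreeUpTo N (partial-telescopes N) ⟩
    one ⊖ power (suc N)                ≈⟨ agree (λ i j M M≤N → ≡.trans (≡.cong (λ c → one i j M ℤ.+ ℤ.- c)
                                              (q^∣-mono _ _ _ _ i j M (s≤s (ℕₚ.≤-trans M≤N (ℕₚ.m≤m+n N (k ℕ.* suc N))))))
                                              (ℤₚ.+-identityʳ _)) ⟩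
    one                                ∎

open GeometricSeries using (geomInv-inverse)

atZ0 : Ser → Ser
atZ0 F i zero    N = F i 0 N
atZ0 F i (suc j) N = 0ℤ

atA0 : Ser → Ser
atA0 F zero    j N = F 0 j N
atA0 F (suc i) j N = 0ℤ

atZ0-isMultiplicative : IsMultiplicative atZ0
atZ0-isMultiplicative = record { π-cong = cong ; π-⊗ = homo ; π-one = one-homo }
  where
  cong : ∀ {F G} → F ≈ G → atZ0 F ≈ atZ0 G
  cong F≈G i zero    N = F≈G i 0 N
  cong F≈G i (suc j) N = refl
  homo : ∀ F G → atZ0 (F ⊗ G) ≈ atZ0 F ⊗ atZ0 G
  homo F G i zero    N = refl
  homo F G i (suc j) N = ≡.sym (sumTo-zero i (λ i₁ _ → sumTo-zero (suc j) (λ j₁ _ → sumTo-zero N (λ n₁ _ → term i₁ j₁ n₁))))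
    where
    term : ∀ i₁ j₁ n₁ → atZ0 F i₁ j₁ n₁ ℤ.* atZ0 G (i ∸ i₁) (suc j ∸ j₁) (N ∸ n₁) ≡ 0ℤ
    term i₁ zero     n₁ = ℤₚ.*-zeroʳ (F i₁ 0 n₁)
    term i₁ (suc j₁) n₁ = refl
  one-homo : atZ0 one ≈ one
  one-homo i       zero    N = refl
  one-homo zero    (suc j) N = refl
  one-homo (suc i) (suc j) N = refl

atA0-isMultiplicative : IsMultiplicative atA0
atA0-isMultiplicative = record { π-cong = cong ; π-⊗ = homo ; π-one = one-homo }
  where
  cong : ∀ {F G} → F ≈ G → atA0 F ≈ atA0 G
  cong F≈G zero    j N = F≈G 0 j N
  cong F≈G (suc i) j N = refl
  homo : ∀ F G → atA0 (F ⊗ G) ≈ atA0 F ⊗ atA0 G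
  homo F G zero    j N = refl
  homo F G (suc i) j N = ≡.sym (sumTo-zero (suc i) (λ i₁ _ → sumTo-zero j (λ j₁ _ → sumTo-zero N (λ n₁ _ → term i₁ j₁ n₁))))
    where
    term : ∀ i₁ j₁ n₁ → atA0 F i₁ j₁ n₁ ℤ.* atA0 G (suc i ∸ i₁) (j ∸ j₁) (N ∸ n₁) ≡ 0ℤ
    term zero     j₁ n₁ = ℤₚ.*-zeroʳ (F 0 j₁ n₁)
    term (suc i₁) j₁ n₁ = refl
  one-homo : atA0 one ≈ one
  one-homo zero    j N = refl
  one-homo (suc i) j N = refl

module AtZ0 = IsMultiplicative atZ0-isMultiplicative
  renaming (π-⊗ to atZ0-⊗; π-one to atZ0-one; π-prod1to to atZ0-prod1to; π-inverse to atZ0-inverse;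
            Fixed to Z-free; fixed-⊗ to z-free-⊗; fixed-prod1to to z-free-prod1to)
module AtA0 = IsMultiplicative atA0-isMultiplicative
  renaming (π-cong to atA0-cong; π-⊗ to atA0-⊗; π-one to atA0-one; π-prod1to to atA0-prod1to;
            Fixed to A-free; fixed-prod1to to a-free-prod1to)
open AtZ0 using (atZ0-⊗; atZ0-one; atZ0-prod1to; atZ0-inverse; Z-free; z-free-⊗; z-free-prod1to)
open AtA0 using (atA0-cong; atA0-⊗; atA0-one; atA0-prod1to; A-free; a-free-prod1to)

atZ0-⊕ : ∀ F G → atZ0 (F ⊕ G) ≈ atZ0 F ⊕ atZ0 G
atZ0-⊕ F G i zero    N = refl
atZ0-⊕ F G i (suc j) N = refl

atA0-⊕ : ∀ F G → atA0 (F ⊕ G) ≈ atA0 F ⊕ atA0 G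
atA0-⊕ F G zero    j N = refl
atA0-⊕ F G (suc i) j N = refl

atZ0-sumQ : ∀ F → atZ0 (sumQ F) ≈ sumQ (atZ0 ∘ F)
atZ0-sumQ F i zero    N = refl
atZ0-sumQ F i (suc j) N = ≡.sym (sumTo-zero N (λ _ _ → refl))

atA0-sumQ : ∀ F → atA0 (sumQ F) ≈ sumQ (atA0 ∘ F)
atA0-sumQ F zero    j N = refl
atA0-sumQ F (suc i) j N = ≡.sym (sumTo-zero N (λ _ _ → refl))

atZ0-mono : ∀ c α β k → atZ0 (mono c α (suc β) k) ≈ 0#
atZ0-mono c α β k i zero    N = mono-off c α (suc β) k i 0 N (inj₂ (inj₁ λ ()))
atZ0-mono c α β k i (suc j) N = refl

atA0-mono : ∀ c α β k → atA0 (mono c (suc α) β k) ≈ 0#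
atA0-mono c α β k zero    j N = mono-off c (suc α) β k 0 j N (inj₁ λ ())
atA0-mono c α β k (suc i) j N = refl

z-free-mono : ∀ c α k → Z-free (mono c α 0 k)
z-free-mono c α k i zero    N = refl
z-free-mono c α k i (suc j) N = ≡.sym (mono-off c α 0 k i (suc j) N (inj₂ (inj₁ λ ())))

z-free-geomInv : ∀ s α k → Z-free (geomInv s α 0 k)
z-free-geomInv s α k i zero    N = refl
z-free-geomInv s α k i (suc j) N = ≡.sym (sumTo-zero N λ m _ → mono-off _ (α ℕ.* m) 0 (k ℕ.* m) i (suc j) N (inj₂ (inj₁ λ ())))

a-free-geomInv : ∀ s β k → A-free (geomInv s 0 β k)
a-free-geomInv s β k zero    j N = refl
a-free-geomInv s β k (suc i) j N = ≡.sym (sumTo-zero N λ m _ → mono-off ((ℤ.- s) ℤ.^ m) 0 (β ℕ.* m) (k ℕ.* m) (suc i) j N (inj₁ λ ()))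

z-free-poch : ∀ s α n → Z-free (poch s α 0 n)
z-free-poch s α n = z-free-prod1to n _ λ k → trans (atZ0-⊕ one (mono s α 0 (suc k))) (+-cong atZ0-one (z-free-mono s α (suc k)))

z-free-invPoch : ∀ s α n → Z-free (invPoch s α 0 n)
z-free-invPoch s α n = z-free-prod1to n (geomInv s α 0) (λ k → z-free-geomInv s α (suc k))

a-free-invPoch : ∀ s β n → A-free (invPoch s 0 β n)
a-free-invPoch s β n = a-free-prod1to n (geomInv s 0 β) (λ k → a-free-geomInv s β (suc k))

z-free-pochInf : ∀ s α → Z-free (pochInf s α 0)
z-free-pochInf s α i zero    N = refl
z-free-pochInf s α i (suc j) N = z-free-poch s α N i (suc j) N

dilate-z-free : ∀ v {F} → Z-free F → dilate 0 v F ≈ F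
dilate-z-free v F-free i zero    N rewrite ℕₚ.*-zeroʳ v = refl
dilate-z-free v F-free i (suc j) N =
  ≡.trans ([≤]-zero (v ℕ.* suc j) N (λ _ → ≡.sym (F-free i (suc j) _))) (F-free i (suc j) N)

dilate-a-free : ∀ u {F} → A-free F → dilate u 0 F ≈ F
dilate-a-free u F-free zero    j N rewrite ℕₚ.*-zeroʳ u = refl
dilate-a-free u F-free (suc i) j N =
  ≡.trans ([≤]-zero (u ℕ.* suc i ℕ.+ 0) N (λ _ → ≡.sym (F-free (suc i) j _))) (F-free (suc i) j N)

-- The q-difference equation

σ σ² : Ser → Ser
σ  = dilate 0 1
σ² = dilate 0 2

1+zq^ : ℕ → Ser
1+zq^ k = one ⊕ mono 1ℤ 0 1 k

azq² : Ser
azq² = mono 1ℤ 1 1 2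

extra : Ser → ℕ → ℕ → ℕ → ℤ
extra F zero    j = λ _ → 0ℤ
extra F (suc i) j = q^ suc j · F i j

-- Coefficientwise form of F(a,0,q) = 1 and F(z) = (1 + zq) F(zq) + a z q² F(zq²).
record IsSolution (F : Ser) : Set where
  field
    initial : atZ0 F ≈ one
    step    : ∀ i j N → F i (suc j) N ≡ (q^ suc j · λ M → F i (suc j) M ℤ.+ F i j M ℤ.+ extra F i j M) N

lex-induction : (P : ℕ → ℕ → ℕ → Set) →
  (∀ i N → P i 0 N) →
  (∀ j N → (∀ i M → P i j M) → (∀ i M → M < N → P i (suc j) M) → ∀ i → P i (suc j) N) →
  ∀ i j N → P i j N
lex-induction P base step i zero    N = base i N
lex-induction P base step i (suc j) N =
  <-rec (λ N → ∀ i → P i (suc j) N) (λ N rec → step j N (λ i M → lex-induction P base step i j M) (λ i M M<N → rec M<N i)) N i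

shifted< : ∀ j {N} → suc j ≤ N → N ∸ suc j < N
shifted< j = ℕₚ.∸-monoʳ-< (s≤s z≤n)

solution-unique : ∀ {F G} → IsSolution F → IsSolution G → F ≈ G
solution-unique {F} {G} F-sol G-sol = lex-induction (λ i j N → F i j N ≡ G i j N) base step
  where
  module F = IsSolution F-sol
  module G = IsSolution G-sol
  base : ∀ i N → F i 0 N ≡ G i 0 N
  base i N = ≡.trans (F.initial i 0 N) (≡.sym (G.initial i 0 N))
  step : ∀ j N → (∀ i M → F i j M ≡ G i j M) → (∀ i M → M < N → F i (suc j) M ≡ G i (suc j) M) →
         ∀ i → F i (suc j) N ≡ G i (suc j) N
  step j N F≡G F≡G′ i = ≡.trans (F.step i j N) (≡.trans
    ([≤]-cong (suc j) N λ 1+j≤N → ≡.cong₂ ℤ._+_ (≡.cong₂ ℤ._+_ (F≡G′ i _ (shifted< j 1+j≤N)) (F≡G i _)) (extra-≡ i))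
    (≡.sym (G.step i j N)))
    where
    extra-≡ : ∀ i → extra F i j (N ∸ suc j) ≡ extra G i j (N ∸ suc j)
    extra-≡ zero     = refl
    extra-≡ (suc i′) = q^·-cong (suc j) (F≡G i′) (N ∸ suc j)

σ-coeff : ∀ F i j N → σ F i j N ≡ (q^ j · F i j) N
σ-coeff F i j N = q^·-exponent (F i j) N (ℕₚ.+-identityʳ j)

σ²-coeff : ∀ F i j N → σ² F i j N ≡ (q^ j ℕ.+ j · F i j) N
σ²-coeff F i j N = q^·-exponent (F i j) N (≡.cong (j ℕ.+_) (ℕₚ.+-identityʳ j))

coeff-1+zq⊗σ : ∀ F i j N → (1+zq^ 1 ⊗ σ F) i (suc j) N ≡ (q^ suc j · F i (suc j)) N ℤ.+ (q^ suc j · F i j) N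
coeff-1+zq⊗σ F i j N = begin
  (1+zq^ 1 ⊗ σ F) i (suc j) N
    ≡⟨ *-comm (1+zq^ 1) (σ F) i (suc j) N ⟩
  (σ F ⊗ 1+zq^ 1) i (suc j) N
    ≡⟨ coeff-⊗-1+mono 1ℤ 0 1 1 (σ F) i (suc j) N ⟩
  σ F i (suc j) N ℤ.+ [ 1 ≤ N ] (1ℤ ℤ.* σ F i j (N ∸ 1))
    ≡⟨ ≡.cong₂ ℤ._+_ (σ-coeff F i (suc j) N)
                     (≡.cong ([ 1 ≤ N ]_) (≡.trans (ℤₚ.*-identityˡ _) (σ-coeff F i j (N ∸ 1)))) ⟩
  (q^ suc j · F i (suc j)) N ℤ.+ (q^ 1 · q^ j · F i j) N
    ≡⟨ ≡.cong (λ x → (q^ suc j · F i (suc j)) N ℤ.+ x) (q^·-q^· 1 j (F i j) N) ⟩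
  (q^ suc j · F i (suc j)) N ℤ.+ (q^ suc j · F i j) N ∎
  where open ≡.≡-Reasoning

coeff-azq²⊗σ² : ∀ F i j N → (azq² ⊗ σ² F) i (suc j) N ≡ (q^ suc j · extra F i j) N
coeff-azq²⊗σ² F zero    j N = ≡.trans (coeff-mono-⊗ 1ℤ 1 1 2 (σ² F) 0 (suc j) N) (≡.sym ([≤]-zero (suc j) N (λ _ → refl)))
coeff-azq²⊗σ² F (suc i) j N = begin
  (azq² ⊗ σ² F) (suc i) (suc j) N
    ≡⟨ coeff-mono-⊗ 1ℤ 1 1 2 (σ² F) (suc i) (suc j) N ⟩
  [ 2 ≤ N ] (1ℤ ℤ.* σ² F i j (N ∸ 2))
    ≡⟨ ≡.cong ([ 2 ≤ N ]_) (≡.trans (ℤₚ.*-identityˡ _) (σ²-coeff F i j (N ∸ 2))) ⟩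
  (q^ 2 · q^ j ℕ.+ j · F i j) N
    ≡⟨ q^·-q^· 2 (j ℕ.+ j) (F i j) N ⟩
  (q^ 2 ℕ.+ (j ℕ.+ j) · F i j) N
    ≡⟨ q^·-exponent (F i j) N (≡.cong suc (≡.sym (ℕₚ.+-suc j j))) ⟩
  (q^ suc j ℕ.+ suc j · F i j) N
    ≡⟨ q^·-q^· (suc j) (suc j) (F i j) N ⟨
  (q^ suc j · q^ suc j · F i j) N ∎
  where open ≡.≡-Reasoning

functional-equation⇒step : ∀ F → F ≈ 1+zq^ 1 ⊗ σ F ⊕ azq² ⊗ σ² F →
  ∀ i j N → F i (suc j) N ≡ (q^ suc j · λ M → F i (suc j) M ℤ.+ F i j M ℤ.+ extra F i j M) N
functional-equation⇒step F F≈ i j N = begin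
  F i (suc j) N
    ≡⟨ F≈ i (suc j) N ⟩
  (1+zq^ 1 ⊗ σ F) i (suc j) N ℤ.+ (azq² ⊗ σ² F) i (suc j) N
    ≡⟨ ≡.cong₂ ℤ._+_ (coeff-1+zq⊗σ F i j N) (coeff-azq²⊗σ² F i j N) ⟩
  (q^ suc j · F i (suc j)) N ℤ.+ (q^ suc j · F i j) N ℤ.+ (q^ suc j · extra F i j) N
    ≡⟨ ≡.trans (q^·-+ (suc j) (λ M → F i (suc j) M ℤ.+ F i j M) (extra F i j) N)
               (≡.cong (ℤ._+ (q^ suc j · extra F i j) N) (q^·-+ (suc j) (F i (suc j)) (F i j) N)) ⟨
  (q^ suc j · λ M → F i (suc j) M ℤ.+ F i j M ℤ.+ extra F i j M) N ∎
  where open ≡.≡-Reasoning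

-- The first sum Σ (-aq;q)_n z^n q^{n(n+1)/2} / (q;q)_n

tri-suc : ∀ j → tri (suc j) ≡ tri j ℕ.+ suc j
tri-suc j = ≡.trans (≡.cong (_/ 2) (expand j))
  (≡.trans (+-distrib-/-∣ʳ (j ℕ.* suc j) (divides (suc j) refl)) (≡.cong (tri j ℕ.+_) (m*n/n≡m (suc j) 2)))
  where
  open +-*-Solver
  expand : ∀ j → suc j ℕ.* suc (suc j) ≡ j ℕ.* suc j ℕ.+ suc j ℕ.* 2
  expand = solve 1 (λ j → (con 1 :+ j) :* (con 2 :+ j) := j :* (con 1 :+ j) :+ (con 1 :+ j) :* con 2) refl

n≤tri : ∀ n → n ≤ tri n
n≤tri zero    = z≤n
n≤tri (suc n) = ≡.subst (suc n ≤_) (≡.sym (tri-suc n)) (ℕₚ.m≤n+m (suc n) (tri n))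

-- If G satisfies the recurrence without its outer factor q^{j+1}, then F = q^{tri j} G satisfies it.
tri-shift-step : ∀ (G F : Ser) →
  (∀ i j N → F i j N ≡ (q^ tri j · G i j) N) →
  (∀ i j M → G i (suc j) M ≡ (q^ suc j · G i (suc j)) M ℤ.+ G i j M ℤ.+ extra G i j M) →
  ∀ i j N → F i (suc j) N ≡ (q^ suc j · λ M → F i (suc j) M ℤ.+ F i j M ℤ.+ extra F i j M) N
tri-shift-step G F F≡q^G G-step i j N = begin
  F i (suc j) N                           ≡⟨ F≡q^G i (suc j) N ⟩
  (q^ tri (suc j) · G i (suc j)) N        ≡⟨ q^·-exponent (G i (suc j)) N tri[1+j]≡1+j+tri[j] ⟩
  (q^ suc j ℕ.+ tri j · G i (suc j)) N    ≡⟨ q^·-q^· (suc j) (tri j) (G i (suc j)) N ⟨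
  (q^ suc j · q^ tri j · G i (suc j)) N   ≡⟨ q^·-cong (suc j) inner N ⟩
  (q^ suc j · λ M → F i (suc j) M ℤ.+ F i j M ℤ.+ extra F i j M) N ∎
  where
  open ≡.≡-Reasoning
  tri[1+j]≡1+j+tri[j] : tri (suc j) ≡ suc j ℕ.+ tri j
  tri[1+j]≡1+j+tri[j] = ≡.trans (tri-suc j) (ℕₚ.+-comm (tri j) (suc j))
  shifted-extra : ∀ i M → (q^ tri j · extra G i j) M ≡ extra F i j M
  shifted-extra zero     M = [≤]-zero (tri j) M (λ _ → refl)
  shifted-extra (suc i′) M = begin
    (q^ tri j · q^ suc j · G i′ j) M    ≡⟨ q^·-q^· (tri j) (suc j) (G i′ j) M ⟩
    (q^ tri j ℕ.+ suc j · G i′ j) M     ≡⟨ q^·-exponent (G i′ j) M (ℕₚ.+-comm (tri j) (suc j)) ⟩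
    (q^ suc j ℕ.+ tri j · G i′ j) M     ≡⟨ q^·-q^· (suc j) (tri j) (G i′ j) M ⟨
    (q^ suc j · q^ tri j · G i′ j) M    ≡⟨ q^·-cong (suc j) (λ M′ → ≡.sym (F≡q^G i′ j M′)) M ⟩
    (q^ suc j · F i′ j) M               ∎
  inner : ∀ M → (q^ tri j · G i (suc j)) M ≡ F i (suc j) M ℤ.+ F i j M ℤ.+ extra F i j M
  inner M = begin
    (q^ tri j · G i (suc j)) M
      ≡⟨ q^·-cong (tri j) (G-step i j) M ⟩
    (q^ tri j · λ M′ → (q^ suc j · G i (suc j)) M′ ℤ.+ G i j M′ ℤ.+ extra G i j M′) M
      ≡⟨ ≡.trans (q^·-+ (tri j) (λ M′ → (q^ suc j · G i (suc j)) M′ ℤ.+ G i j M′) (extra G i j) M)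
           (≡.cong (ℤ._+ (q^ tri j · extra G i j) M) (q^·-+ (tri j) (q^ suc j · G i (suc j)) (G i j) M)) ⟩
    (q^ tri j · q^ suc j · G i (suc j)) M ℤ.+ (q^ tri j · G i j) M ℤ.+ (q^ tri j · extra G i j) M
      ≡⟨ ≡.cong₂ ℤ._+_ (≡.cong₂ ℤ._+_ shifted-top (≡.sym (F≡q^G i j M))) (shifted-extra i M) ⟩
    F i (suc j) M ℤ.+ F i j M ℤ.+ extra F i j M ∎
    where
    shifted-top : (q^ tri j · q^ suc j · G i (suc j)) M ≡ F i (suc j) M
    shifted-top = ≡.trans (q^·-q^· (tri j) (suc j) (G i (suc j)) M)
      (≡.trans (q^·-exponent (G i (suc j)) M (≡.sym (tri-suc j))) (≡.sym (F≡q^G i (suc j) M)))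

termRatio : ℕ → Ser
termRatio n = poch 1ℤ 1 0 n ⊗ invPoch -1ℤ 0 0 n

-- Σ_n z^n (-aq;q)_n/(q;q)_n, that is, rhs1 without the factors q^{n(n+1)/2}.
ratioSum : Ser
ratioSum i n M = termRatio n i 0 M

z-free-termRatio : ∀ n → Z-free (termRatio n)
z-free-termRatio n = z-free-⊗ (z-free-poch 1ℤ 1 n) (z-free-invPoch -1ℤ 0 n)

rhs1-coefficient : ∀ i j N → rhs1 i j N ≡ (q^ tri j · ratioSum i j) N
rhs1-coefficient i j N = begin
  sumTo N (λ n → (termRatio n ⊗ mono 1ℤ 0 n (tri n)) i j N)
    ≡⟨ sumTo-cong N (λ n _ → coeff-⊗-mono 1ℤ 0 n (tri n) (termRatio n) i j N) ⟩
  sumTo N (λ n → [ n ≤ j ] [ tri n ≤ N ] (1ℤ ℤ.* termRatio n i (j ∸ n) (N ∸ tri n)))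
    ≡⟨ sumTo-single N j (λ n n≢j → [≤]-zero n j (λ n≤j → [≤]-zero (tri n) N (λ _ →
         ≡.trans (ℤₚ.*-identityˡ _) (off-diagonal n (ℕₚ.≤∧≢⇒< n≤j n≢j))))) ⟩
  [ j ≤ N ] [ j ≤ j ] [ tri j ≤ N ] (1ℤ ℤ.* termRatio j i (j ∸ j) (N ∸ tri j))
    ≡⟨ ≡.cong ([ j ≤ N ]_) (≡.trans ([≤]-true {j} {j} _ ℕₚ.≤-refl)
         (≡.cong ([ tri j ≤ N ]_) (≡.trans (ℤₚ.*-identityˡ _) (≡.cong (λ m → termRatio j i m (N ∸ tri j)) (ℕₚ.n∸n≡0 j))))) ⟩
  [ j ≤ N ] [ tri j ≤ N ] ratioSum i j (N ∸ tri j)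
    ≡⟨ [≤]-absorb j (tri j) N (ratioSum i j (N ∸ tri j)) (n≤tri j) ⟩
  (q^ tri j · ratioSum i j) N ∎
  where
  open ≡.≡-Reasoning
  off-diagonal : ∀ n → n < j → termRatio n i (j ∸ n) (N ∸ tri n) ≡ 0ℤ
  off-diagonal n (s≤s {n = j′} n≤j′) =
    ≡.trans (≡.cong (λ m → termRatio n i m (N ∸ tri n)) (ℕₚ.+-∸-assoc 1 n≤j′))
            (≡.sym (z-free-termRatio n i (suc (j′ ∸ n)) (N ∸ tri n)))

termRatio-step : ∀ n → termRatio (suc n) ⊗ (one ⊕ mono -1ℤ 0 0 (suc n)) ≈ termRatio n ⊗ (one ⊕ mono 1ℤ 1 0 (suc n))
termRatio-step n = begin
  ((P ⊗ A) ⊗ (Q ⊗ g)) ⊗ B   ≈⟨ ⊗-solve 5 (λ p a q g b → ((p · a) · (q · g)) · b ⊜ (p · q) · (a · (g · b))) ≈-refl P A Q g B ⟩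
  (P ⊗ Q) ⊗ (A ⊗ (g ⊗ B))   ≈⟨ ⊗-congˡ (P ⊗ Q) (⊗-congˡ A (geomInv-inverse -1ℤ 0 0 n)) ⟩
  (P ⊗ Q) ⊗ (A ⊗ one)       ≈⟨ ⊗-congˡ (P ⊗ Q) (*-identityʳ A) ⟩
  (P ⊗ Q) ⊗ A               ∎
  where
  open SetoidReasoning setoid
  P = poch 1ℤ 1 0 n
  Q = invPoch -1ℤ 0 0 n
  A = one ⊕ mono 1ℤ 1 0 (suc n)
  g = geomInv -1ℤ 0 0 (suc n)
  B = one ⊕ mono -1ℤ 0 0 (suc n)

ratioSum-step : ∀ i n M → ratioSum i (suc n) M ≡ (q^ suc n · ratioSum i (suc n)) M ℤ.+ ratioSum i n M ℤ.+ extra ratioSum i n M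
ratioSum-step i n M = rearrange (begin
  ratioSum i (suc n) M ℤ.+ -1ℤ ℤ.* (q^ suc n · ratioSum i (suc n)) M
    ≡⟨ ≡.cong (λ x → ratioSum i (suc n) M ℤ.+ x) ([≤]-* (suc n) M -1ℤ _) ⟨
  ratioSum i (suc n) M ℤ.+ [ suc n ≤ M ] (-1ℤ ℤ.* termRatio (suc n) i 0 (M ∸ suc n))
    ≡⟨ coeff-⊗-1+mono -1ℤ 0 0 (suc n) (termRatio (suc n)) i 0 M ⟨
  (termRatio (suc n) ⊗ (one ⊕ mono -1ℤ 0 0 (suc n))) i 0 M
    ≡⟨ termRatio-step n i 0 M ⟩
  (termRatio n ⊗ (one ⊕ mono 1ℤ 1 0 (suc n))) i 0 M
    ≡⟨ coeff-⊗-1+mono 1ℤ 1 0 (suc n) (termRatio n) i 0 M ⟩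
  ratioSum i n M ℤ.+ [ 1 ≤ i ] [ suc n ≤ M ] (1ℤ ℤ.* termRatio n (i ∸ 1) 0 (M ∸ suc n))
    ≡⟨ ≡.cong (λ x → ratioSum i n M ℤ.+ x) (extra-term i) ⟩
  ratioSum i n M ℤ.+ extra ratioSum i n M ∎)
  where
  open ≡.≡-Reasoning
  extra-term : ∀ i → [ 1 ≤ i ] [ suc n ≤ M ] (1ℤ ℤ.* termRatio n (i ∸ 1) 0 (M ∸ suc n)) ≡ extra ratioSum i n M
  extra-term zero    = refl
  extra-term (suc i) = ≡.cong ([ suc n ≤ M ]_) (ℤₚ.*-identityˡ _)
  rearrange : ∀ {r′ s r e} → r′ ℤ.+ -1ℤ ℤ.* s ≡ r ℤ.+ e → r′ ≡ s ℤ.+ r ℤ.+ e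
  rearrange {r′} {s} {r} {e} eq = ≡.trans (identity r′ s) (≡.trans (≡.cong (ℤ._+ s) eq) (identity′ r e s))
    where
    open ℤ-Solver
    identity : ∀ r′ s → r′ ≡ (r′ ℤ.+ -1ℤ ℤ.* s) ℤ.+ s
    identity = solve 2 (λ r′ s → r′ := (r′ :+ con -1ℤ :* s) :+ s) refl
    identity′ : ∀ r e s → (r ℤ.+ e) ℤ.+ s ≡ s ℤ.+ r ℤ.+ e
    identity′ = solve 3 (λ r e s → (r :+ e) :+ s := s :+ r :+ e) refl

rhs1-isSolution : IsSolution rhs1
rhs1-isSolution = record
  { initial = initial
  ; step    = tri-shift-step ratioSum rhs1 rhs1-coefficient ratioSum-step
  }
  where
  initial : atZ0 rhs1 ≈ one
  initial i zero    N = ≡.trans (rhs1-coefficient i 0 N) (*-identityˡ one i 0 N)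
  initial zero    (suc j) N = refl
  initial (suc i) (suc j) N = refl

-- The product side

-- A∞ = (-aq;q)_∞, Z∞ = (-zq;q)_∞, X n = (-aq)^n, Qinv n = 1/(q;q)_n and Winv n = 1/(-zq;q)_n,
-- so that rhs2 = A∞ Z∞ S.
A∞ Z∞ : Ser
A∞ = pochInf 1ℤ 1 0
Z∞ = pochInf 1ℤ 0 1

X Qinv Winv : ℕ → Ser
X n    = mono (-1ℤ ℤ.^ n) n 0 n
Qinv n = invPoch -1ℤ 0 0 n
Winv n = invPoch 1ℤ 0 1 n

-- 1/(-zq^{1+v};q)_n
WinvFrom : ℕ → ℕ → Ser
WinvFrom v n = prod1to n (λ k → geomInv 1ℤ 0 1 (k ℕ.+ v))

1/1+zq^ : ℕ → Ser
1/1+zq^ k = geomInv 1ℤ 0 1 k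

dilate-1/1+zq^ : ∀ v k → dilate 0 v (1/1+zq^ (suc k)) ≈ 1/1+zq^ (suc k ℕ.+ v)
dilate-1/1+zq^ v k = inverse-unique {G = 1+zq^ (suc k ℕ.+ v)}
  (trans (⊗-congˡ (dilate 0 v (1/1+zq^ (suc k))) (sym σᵛ[1+zq^k+1]))
         (IsMultiplicative.π-inverse (dilate-isMultiplicative 0 v) {1/1+zq^ (suc k)} {1+zq^ (suc k)} (geomInv-inverse 1ℤ 0 1 k)))
  (geomInv-inverse 1ℤ 0 1 (k ℕ.+ v))
  where
  σᵛ[1+zq^k+1] : dilate 0 v (1+zq^ (suc k)) ≈ 1+zq^ (suc k ℕ.+ v)
  σᵛ[1+zq^k+1] = trans (dilate-1+mono 0 v 1ℤ 0 1 (suc k))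
    (+-congˡ {one} (mono-cong refl refl refl (≡.trans (≡.cong (ℕ._+ suc k) (ℕₚ.*-identityʳ v)) (ℕₚ.+-comm v (suc k)))))

dilate-Winv : ∀ v n → dilate 0 v (Winv n) ≈ WinvFrom v n
dilate-Winv v n = trans (IsMultiplicative.π-prod1to (dilate-isMultiplicative 0 v) n (1/1+zq^)) (prod1to-cong n (dilate-1/1+zq^ v))

Winv-unfold₁ : ∀ n → Winv (suc n) ≈ 1/1+zq^ 1 ⊗ WinvFrom 1 n
Winv-unfold₁ n = trans (prod1to-unfoldˡ n 1/1+zq^)
  (⊗-congˡ (1/1+zq^ 1) (prod1to-cong n (λ k → reflexive (≡.cong 1/1+zq^ (ℕₚ.+-comm 1 (suc k))))))

Winv-unfold₂ : ∀ n → Winv (suc (suc n)) ≈ 1/1+zq^ 1 ⊗ (1/1+zq^ 2 ⊗ WinvFrom 2 n)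
Winv-unfold₂ n = trans (prod1to-unfoldˡ (suc n) 1/1+zq^)
  (⊗-congˡ (1/1+zq^ 1) (trans (prod1to-unfoldˡ n (1/1+zq^ ∘ suc))
    (⊗-congˡ (1/1+zq^ 2) (prod1to-cong n (λ k → reflexive (≡.cong 1/1+zq^ (ℕₚ.+-comm 2 (suc k))))))))

Z∞-unfold : Z∞ ≈ 1+zq^ 1 ⊗ σ Z∞
Z∞-unfold = pochInf-unfold 1ℤ 0 1 0 1 refl

Z∞-unfold² : Z∞ ≈ 1+zq^ 1 ⊗ (1+zq^ 2 ⊗ σ² Z∞)
Z∞-unfold² = trans Z∞-unfold (⊗-congˡ (1+zq^ 1) (begin
  σ Z∞                        ≈⟨ dilate-cong 0 1 Z∞-unfold ⟩
  σ (1+zq^ 1 ⊗ σ Z∞)          ≈⟨ dilate-⊗ 0 1 (1+zq^ 1) (σ Z∞) ⟩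
  σ (1+zq^ 1) ⊗ σ (σ Z∞)      ≈⟨ *-cong (dilate-1+mono 0 1 1ℤ 0 1 1) (dilate-dilate 0 1 0 1 Z∞) ⟩
  1+zq^ 2 ⊗ σ² Z∞             ∎))
  where open SetoidReasoning setoid

S : Ser
S = sumQ (λ n → X n ⊗ Qinv n ⊗ Winv n)

z-free-X : ∀ n → Z-free (X n)
z-free-X n = z-free-mono (-1ℤ ℤ.^ n) n n

z-free-Qinv : ∀ n → Z-free (Qinv n)
z-free-Qinv = z-free-invPoch -1ℤ 0

q^n∣X⊗ : ∀ n F G → q^ n ∣ X n ⊗ F ⊗ G
q^n∣X⊗ n F G = q^∣-⊗ʳ n G (q^∣-⊗ʳ n F (q^∣-mono (-1ℤ ℤ.^ n) n 0 n))

dilate-S : ∀ v → dilate 0 v S ≈ sumQ (λ n → X n ⊗ Qinv n ⊗ WinvFrom v n)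
dilate-S v = trans (dilate-sumQ 0 v _ (λ n → q^n∣X⊗ n (Qinv n) (Winv n))) (sumQ-cong λ n → begin
  dilate 0 v (X n ⊗ Qinv n ⊗ Winv n)                   ≈⟨ dilate-⊗ 0 v (X n ⊗ Qinv n) (Winv n) ⟩
  dilate 0 v (X n ⊗ Qinv n) ⊗ dilate 0 v (Winv n)      ≈⟨ *-cong (trans (dilate-⊗ 0 v (X n) (Qinv n))
                                                                (*-cong (dilate-z-free v (z-free-X n)) (dilate-z-free v (z-free-Qinv n))))
                                                         (dilate-Winv v n) ⟩
  X n ⊗ Qinv n ⊗ WinvFrom v n                          ∎)
  where open SetoidReasoning setoid

Winv-difference : ∀ n → Winv n ⊖ WinvFrom 1 n ≈ Winv (suc n) ⊗ (mono 1ℤ 0 1 (suc n) ⊖ mono 1ℤ 0 1 1)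
Winv-difference n = begin
  Winv n ⊖ WinvFrom 1 n                                ≈⟨ +-cong (sym drop-top) (-‿cong (sym drop-bottom)) ⟩
  W′ ⊗ 1+zq^ (suc n) ⊖ W′ ⊗ 1+zq^ 1                    ≈⟨ ⊗-distribˡ-⊖ W′ (1+zq^ (suc n)) (1+zq^ 1) ⟩
  W′ ⊗ (1+zq^ (suc n) ⊖ 1+zq^ 1)                       ≈⟨ ⊗-congˡ W′ (1+-⊖-1+ (mono 1ℤ 0 1 (suc n)) (mono 1ℤ 0 1 1)) ⟩
  W′ ⊗ (mono 1ℤ 0 1 (suc n) ⊖ mono 1ℤ 0 1 1)           ∎
  where
  open SetoidReasoning setoid
  W′ = Winv (suc n)
  drop-top : W′ ⊗ 1+zq^ (suc n) ≈ Winv n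
  drop-top = trans (*-assoc (Winv n) (1/1+zq^ (suc n)) (1+zq^ (suc n)))
                   (trans (⊗-congˡ (Winv n) (geomInv-inverse 1ℤ 0 1 n)) (*-identityʳ (Winv n)))
  drop-bottom : W′ ⊗ 1+zq^ 1 ≈ WinvFrom 1 n
  drop-bottom = begin
    W′ ⊗ 1+zq^ 1                           ≈⟨ ⊗-congʳ (1+zq^ 1) (Winv-unfold₁ n) ⟩
    1/1+zq^ 1 ⊗ WinvFrom 1 n ⊗ 1+zq^ 1
      ≈⟨ ⊗-solve 3 (λ g w z → (g · w) · z ⊜ w · (g · z)) ≈-refl (1/1+zq^ 1) (WinvFrom 1 n) (1+zq^ 1) ⟩
    WinvFrom 1 n ⊗ (1/1+zq^ 1 ⊗ 1+zq^ 1)   ≈⟨ ⊗-congˡ (WinvFrom 1 n) (geomInv-inverse 1ℤ 0 1 0) ⟩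
    WinvFrom 1 n ⊗ one                     ≈⟨ *-identityʳ (WinvFrom 1 n) ⟩
    WinvFrom 1 n                           ∎

-aq : Ser
-aq = mono -1ℤ 1 0 1

X-suc : ∀ m → X (suc m) ≈ -aq ⊗ X m
X-suc m = sym (mono-⊗-mono -1ℤ (-1ℤ ℤ.^ m) 1 0 1 m 0 m)

eulerTerm-step : ∀ m → X (suc m) ⊗ Qinv (suc m) ⊗ (one ⊕ mono -1ℤ 0 0 (suc m)) ≈ -aq ⊗ (X m ⊗ Qinv m)
eulerTerm-step m = begin
  X (suc m) ⊗ Qinv (suc m) ⊗ B          ≈⟨ ⊗-congʳ B (⊗-congʳ (Qinv (suc m)) (X-suc m)) ⟩
  (-aq ⊗ X m) ⊗ (Qinv m ⊗ g) ⊗ B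
    ≈⟨ ⊗-solve 5 (λ a x q g b → ((a · x) · (q · g)) · b ⊜ (a · (x · q)) · (g · b)) ≈-refl -aq (X m) (Qinv m) g B ⟩
  (-aq ⊗ (X m ⊗ Qinv m)) ⊗ (g ⊗ B)      ≈⟨ ⊗-congˡ (-aq ⊗ (X m ⊗ Qinv m)) (geomInv-inverse -1ℤ 0 0 m) ⟩
  (-aq ⊗ (X m ⊗ Qinv m)) ⊗ one          ≈⟨ *-identityʳ _ ⟩
  -aq ⊗ (X m ⊗ Qinv m)                  ∎
  where
  open SetoidReasoning setoid
  g = geomInv -1ℤ 0 0 (suc m)
  B = one ⊕ mono -1ℤ 0 0 (suc m)

-- ΔS n = X n Qinv n (Winv n - σ (Winv n))
ΔS : ℕ → Ser
ΔS n = X n ⊗ Qinv n ⊗ (Winv (suc n) ⊗ (mono 1ℤ 0 1 (suc n) ⊖ mono 1ℤ 0 1 1))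

ΔS-zero : ΔS 0 ≈ 0#
ΔS-zero = trans (⊗-congˡ (X 0 ⊗ Qinv 0) (trans (⊗-congˡ (Winv 1) (-‿inverseʳ (mono 1ℤ 0 1 1))) (zeroʳ (Winv 1))))
                (zeroʳ (X 0 ⊗ Qinv 0))

ΔS-suc : ∀ m → ΔS (suc m) ≈ azq² ⊗ (X m ⊗ Qinv m ⊗ Winv (suc (suc m)))
ΔS-suc m = begin
  X′ ⊗ Q′ ⊗ (W ⊗ (mono 1ℤ 0 1 (suc (suc m)) ⊖ zq))   ≈⟨ ⊗-congˡ (X′ ⊗ Q′) (⊗-congˡ W zq^m+2-zq≈) ⟩
  X′ ⊗ Q′ ⊗ (W ⊗ - (zq ⊗ B))                        ≈⟨ ⊗-congˡ (X′ ⊗ Q′) (-‿distribʳ-* W (zq ⊗ B)) ⟨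
  X′ ⊗ Q′ ⊗ - (W ⊗ (zq ⊗ B))                        ≈⟨ -‿distribʳ-* (X′ ⊗ Q′) (W ⊗ (zq ⊗ B)) ⟨
  - (X′ ⊗ Q′ ⊗ (W ⊗ (zq ⊗ B)))
    ≈⟨ -‿cong (⊗-solve 5 (λ x q w z b → (x · q) · (w · (z · b)) ⊜ ((x · q) · b) · (z · w)) ≈-refl X′ Q′ W zq B) ⟩
  - (X′ ⊗ Q′ ⊗ B ⊗ (zq ⊗ W))                        ≈⟨ -‿cong (⊗-congʳ (zq ⊗ W) (eulerTerm-step m)) ⟩
  - (-aq ⊗ (X m ⊗ Qinv m) ⊗ (zq ⊗ W))
    ≈⟨ -‿cong (⊗-solve 4 (λ a y z w → (a · y) · (z · w) ⊜ (a · z) · (y · w)) ≈-refl -aq (X m ⊗ Qinv m) zq W) ⟩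
  - (-aq ⊗ zq ⊗ (X m ⊗ Qinv m ⊗ W))                 ≈⟨ -‿distribˡ-* (-aq ⊗ zq) (X m ⊗ Qinv m ⊗ W) ⟩
  - (-aq ⊗ zq) ⊗ (X m ⊗ Qinv m ⊗ W)
    ≈⟨ ⊗-congʳ (X m ⊗ Qinv m ⊗ W) (trans (-‿cong (mono-⊗-mono -1ℤ 1ℤ 1 0 1 0 1 1)) (sym (mono-neg -1ℤ 1 1 2))) ⟩
  azq² ⊗ (X m ⊗ Qinv m ⊗ W)                         ∎
  where
  open SetoidReasoning setoid
  X′ = X (suc m)
  Q′ = Qinv (suc m)
  W  = Winv (suc (suc m))
  zq = mono 1ℤ 0 1 1
  B  = one ⊕ mono -1ℤ 0 0 (suc m)
  zq^m+2-zq≈ : mono 1ℤ 0 1 (suc (suc m)) ⊖ zq ≈ - (zq ⊗ B)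
  zq^m+2-zq≈ = sym (begin
    - (zq ⊗ B)                                 ≈⟨ -‿cong (trans (distribˡ zq one (mono -1ℤ 0 0 (suc m)))
                                                    (+-cong (*-identityʳ zq) (mono-⊗-mono 1ℤ -1ℤ 0 1 1 0 0 (suc m)))) ⟩
    - (zq ⊕ mono -1ℤ 0 1 (suc (suc m)))        ≈⟨ ⁻¹-∙-comm zq (mono -1ℤ 0 1 (suc (suc m))) ⟨
    - zq ⊕ - mono -1ℤ 0 1 (suc (suc m))        ≈⟨ ⊕-congˡ (- zq) (sym (mono-neg -1ℤ 0 1 (suc (suc m)))) ⟩
    - zq ⊕ mono 1ℤ 0 1 (suc (suc m))           ≈⟨ +-comm (- zq) (mono 1ℤ 0 1 (suc (suc m))) ⟩
    mono 1ℤ 0 1 (suc (suc m)) ⊖ zq             ∎)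

S-difference : S ⊖ σ S ≈ azq² ⊗ ((1/1+zq^ 1 ⊗ 1/1+zq^ 2) ⊗ σ² S)
S-difference = begin
  S ⊖ σ S                                                  ≈⟨ ⊕-congˡ S (-‿cong (dilate-S 1)) ⟩
  S ⊖ sumQ (λ n → X n ⊗ Qinv n ⊗ WinvFrom 1 n)             ≈⟨ sumQ-⊖ _ _ ⟩
  sumQ (λ n → X n ⊗ Qinv n ⊗ Winv n ⊖ X n ⊗ Qinv n ⊗ WinvFrom 1 n)
    ≈⟨ sumQ-cong (λ n → trans (⊗-distribˡ-⊖ (X n ⊗ Qinv n) (Winv n) (WinvFrom 1 n))
                              (⊗-congˡ (X n ⊗ Qinv n) (Winv-difference n))) ⟩
  sumQ ΔS
    ≈⟨ sumQ-reindex ΔS azq² V (λ n → q^n∣X⊗ n (Qinv n) (Winv (suc n) ⊗ (mono 1ℤ 0 1 (suc n) ⊖ mono 1ℤ 0 1 1)))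
                              (λ m → q^n∣X⊗ m (Qinv m) (Winv (suc (suc m)))) ΔS-zero ΔS-suc ⟩
  azq² ⊗ sumQ V
    ≈⟨ ⊗-congˡ azq² (trans (sumQ-cong V-unfold) (sym (⊗-sumQ g₁₂ _ (λ m → q^n∣X⊗ m (Qinv m) (WinvFrom 2 m))))) ⟩
  azq² ⊗ (g₁₂ ⊗ sumQ (λ n → X n ⊗ Qinv n ⊗ WinvFrom 2 n))  ≈⟨ ⊗-congˡ azq² (⊗-congˡ g₁₂ (dilate-S 2)) ⟨
  azq² ⊗ (g₁₂ ⊗ σ² S)                                      ∎
  where
  open SetoidReasoning setoid
  g₁₂ = 1/1+zq^ 1 ⊗ 1/1+zq^ 2
  V : ℕ → Ser
  V m = X m ⊗ Qinv m ⊗ Winv (suc (suc m))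
  V-unfold : ∀ m → V m ≈ g₁₂ ⊗ (X m ⊗ Qinv m ⊗ WinvFrom 2 m)
  V-unfold m = trans (⊗-congˡ (X m ⊗ Qinv m) (Winv-unfold₂ m))
    (⊗-solve 5 (λ x q a b w → (x · q) · (a · (b · w)) ⊜ (a · b) · ((x · q) · w)) ≈-refl
               (X m) (Qinv m) (1/1+zq^ 1) (1/1+zq^ 2) (WinvFrom 2 m))

dilate-rhs2 : ∀ v → dilate 0 v rhs2 ≈ A∞ ⊗ dilate 0 v Z∞ ⊗ dilate 0 v S
dilate-rhs2 v = trans (dilate-⊗ 0 v (A∞ ⊗ Z∞) S)
  (⊗-congʳ (dilate 0 v S) (trans (dilate-⊗ 0 v A∞ Z∞) (⊗-congʳ (dilate 0 v Z∞) (dilate-z-free v (z-free-pochInf 1ℤ 1)))))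

rhs2-functional-equation : rhs2 ≈ 1+zq^ 1 ⊗ σ rhs2 ⊕ azq² ⊗ σ² rhs2
rhs2-functional-equation = sym (begin
  1+zq^ 1 ⊗ σ rhs2 ⊕ azq² ⊗ σ² rhs2         ≈⟨ +-cong first second ⟩
  A∞ ⊗ Z∞ ⊗ σ S ⊕ A∞ ⊗ Z∞ ⊗ (S ⊖ σ S)      ≈⟨ distribˡ (A∞ ⊗ Z∞) (σ S) (S ⊖ σ S) ⟨
  A∞ ⊗ Z∞ ⊗ (σ S ⊕ (S ⊖ σ S))               ≈⟨ ⊗-congˡ (A∞ ⊗ Z∞) (⊕-⊖-cancel S (σ S)) ⟩
  rhs2                                       ∎)
  where
  open SetoidReasoning setoid
  first : 1+zq^ 1 ⊗ σ rhs2 ≈ A∞ ⊗ Z∞ ⊗ σ S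
  first = begin
    1+zq^ 1 ⊗ σ rhs2                   ≈⟨ ⊗-congˡ (1+zq^ 1) (dilate-rhs2 1) ⟩
    1+zq^ 1 ⊗ (A∞ ⊗ σ Z∞ ⊗ σ S)
      ≈⟨ ⊗-solve 4 (λ z a e s → z · ((a · e) · s) ⊜ (a · (z · e)) · s) ≈-refl (1+zq^ 1) A∞ (σ Z∞) (σ S) ⟩
    A∞ ⊗ (1+zq^ 1 ⊗ σ Z∞) ⊗ σ S        ≈⟨ ⊗-congʳ (σ S) (⊗-congˡ A∞ Z∞-unfold) ⟨
    A∞ ⊗ Z∞ ⊗ σ S                      ∎
  second : azq² ⊗ σ² rhs2 ≈ A∞ ⊗ Z∞ ⊗ (S ⊖ σ S)
  second = sym (begin
    A∞ ⊗ Z∞ ⊗ (S ⊖ σ S)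
      ≈⟨ *-cong (⊗-congˡ A∞ Z∞-unfold²) S-difference ⟩
    A∞ ⊗ (Z₁ ⊗ (Z₂ ⊗ σ² Z∞)) ⊗ (azq² ⊗ ((g₁ ⊗ g₂) ⊗ σ² S))
      ≈⟨ ⊗-solve 8 (λ a z₁ z₂ e m h₁ h₂ s → (a · (z₁ · (z₂ · e))) · (m · ((h₁ · h₂) · s))
                                         ⊜ (m · ((a · e) · s)) · ((h₁ · z₁) · (h₂ · z₂)))
                   ≈-refl A∞ Z₁ Z₂ (σ² Z∞) azq² g₁ g₂ (σ² S) ⟩
    azq² ⊗ (A∞ ⊗ σ² Z∞ ⊗ σ² S) ⊗ ((g₁ ⊗ Z₁) ⊗ (g₂ ⊗ Z₂))
      ≈⟨ ⊗-congˡ (azq² ⊗ (A∞ ⊗ σ² Z∞ ⊗ σ² S))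
           (trans (*-cong (geomInv-inverse 1ℤ 0 1 0) (geomInv-inverse 1ℤ 0 1 1)) (*-identityˡ one)) ⟩
    azq² ⊗ (A∞ ⊗ σ² Z∞ ⊗ σ² S) ⊗ one
      ≈⟨ *-identityʳ _ ⟩
    azq² ⊗ (A∞ ⊗ σ² Z∞ ⊗ σ² S)
      ≈⟨ ⊗-congˡ azq² (dilate-rhs2 2) ⟨
    azq² ⊗ σ² rhs2 ∎)
    where
    Z₁ = 1+zq^ 1
    Z₂ = 1+zq^ 2
    g₁ = 1/1+zq^ 1
    g₂ = 1/1+zq^ 2

-- Euler's identity and the initial condition

q^-fixed⇒zero : ∀ a (φ : ℕ → ℤ) → (∀ M → φ M ≡ (q^ suc a · φ) M) → ∀ N → φ N ≡ 0ℤ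
q^-fixed⇒zero a φ fixed = <-rec _ λ N rec →
  ≡.trans (fixed N) ([≤]-zero (suc a) N (λ 1+a≤N → rec (ℕₚ.∸-monoʳ-< (s≤s z≤n) 1+a≤N)))

-- Under a ↦ aq the coefficient of a^{i+1} q^N moves to q^{N+i+1}, so invariance forces it to vanish.
dilate-a-invariant : ∀ P → dilate 1 0 P ≈ P → atA0 P ≈ one → P ≈ one
dilate-a-invariant P τP≈P atA0P≈1 zero    j N = atA0P≈1 0 j N
dilate-a-invariant P τP≈P atA0P≈1 (suc i) j N = q^-fixed⇒zero i (P (suc i) j) fixed N
  where
  fixed : ∀ M → P (suc i) j M ≡ (q^ suc i · P (suc i) j) M
  fixed M = ≡.trans (≡.sym (τP≈P (suc i) j M))
    (q^·-exponent (P (suc i) j) M (≡.trans (ℕₚ.+-identityʳ (suc i ℕ.+ 0)) (ℕₚ.+-identityʳ (suc i))))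

L : Ser
L = sumQ (λ n → X n ⊗ Qinv n)

q^n∣X⊗Qinv : ∀ n → q^ n ∣ X n ⊗ Qinv n
q^n∣X⊗Qinv n = q^∣-⊗ʳ n (Qinv n) (q^∣-mono (-1ℤ ℤ.^ n) n 0 n)

dilate-X : ∀ n → dilate 1 0 (X n) ≈ X n ⊗ mono 1ℤ 0 0 n
dilate-X n = trans (dilate-mono 1 0 (-1ℤ ℤ.^ n) n 0 n) (sym (trans (mono-⊗-mono (-1ℤ ℤ.^ n) 1ℤ n 0 n 0 0 n)
  (mono-cong (ℤₚ.*-identityʳ _) (ℕₚ.+-identityʳ n) refl
             (≡.cong (ℕ._+ n) (≡.sym (≡.trans (ℕₚ.+-identityʳ (1 ℕ.* n)) (ℕₚ.*-identityˡ n)))))))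

aq : Ser
aq = mono 1ℤ 1 0 1

-- ΔL n = X n Qinv n (q^n - 1), the n-th term of L(aq) - L(a)
ΔL : ℕ → Ser
ΔL n = X n ⊗ Qinv n ⊗ (mono 1ℤ 0 0 n ⊖ one)

ΔL-zero : ΔL 0 ≈ 0#
ΔL-zero = trans (⊗-congˡ (X 0 ⊗ Qinv 0) (-‿inverseʳ one)) (zeroʳ (X 0 ⊗ Qinv 0))

ΔL-suc : ∀ m → ΔL (suc m) ≈ aq ⊗ (X m ⊗ Qinv m)
ΔL-suc m = begin
  X′Q′ ⊗ (mono 1ℤ 0 0 (suc m) ⊖ one)  ≈⟨ ⊗-congˡ X′Q′ q^m+1-1≈-B ⟩
  X′Q′ ⊗ - B                          ≈⟨ -‿distribʳ-* X′Q′ B ⟨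
  - (X′Q′ ⊗ B)                        ≈⟨ -‿cong (eulerTerm-step m) ⟩
  - (-aq ⊗ (X m ⊗ Qinv m))            ≈⟨ -‿distribˡ-* -aq (X m ⊗ Qinv m) ⟩
  - -aq ⊗ (X m ⊗ Qinv m)              ≈⟨ ⊗-congʳ (X m ⊗ Qinv m) (sym (mono-neg -1ℤ 1 0 1)) ⟩
  aq ⊗ (X m ⊗ Qinv m)                 ∎
  where
  open SetoidReasoning setoid
  X′Q′ = X (suc m) ⊗ Qinv (suc m)
  B = one ⊕ mono -1ℤ 0 0 (suc m)
  q^m+1-1≈-B : mono 1ℤ 0 0 (suc m) ⊖ one ≈ - B
  q^m+1-1≈-B = begin
    mono 1ℤ 0 0 (suc m) ⊖ one              ≈⟨ +-comm (mono 1ℤ 0 0 (suc m)) (- one) ⟩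
    - one ⊕ mono 1ℤ 0 0 (suc m)            ≈⟨ ⊕-congˡ (- one) (mono-neg -1ℤ 0 0 (suc m)) ⟩
    - one ⊕ - mono -1ℤ 0 0 (suc m)         ≈⟨ ⁻¹-∙-comm one (mono -1ℤ 0 0 (suc m)) ⟩
    - B                                    ∎

L-difference : dilate 1 0 L ⊖ L ≈ aq ⊗ L
L-difference = begin
  dilate 1 0 L ⊖ L
    ≈⟨ +-cong (trans (dilate-sumQ 1 0 _ q^n∣X⊗Qinv) (sumQ-cong λ n → trans (dilate-⊗ 1 0 (X n) (Qinv n))
                 (*-cong (dilate-X n) (dilate-a-free 1 (a-free-invPoch -1ℤ 0 n))))) ≈-refl ⟩
  sumQ (λ n → X n ⊗ mono 1ℤ 0 0 n ⊗ Qinv n) ⊖ L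
    ≈⟨ sumQ-⊖ _ _ ⟩
  sumQ (λ n → X n ⊗ mono 1ℤ 0 0 n ⊗ Qinv n ⊖ X n ⊗ Qinv n)
    ≈⟨ sumQ-cong (λ n → trans (+-cong (⊗-solve 3 (λ x y z → (x · y) · z ⊜ (x · z) · y) ≈-refl (X n) (mono 1ℤ 0 0 n) (Qinv n))
                                       (-‿cong (sym (*-identityʳ (X n ⊗ Qinv n)))))
                              (⊗-distribˡ-⊖ (X n ⊗ Qinv n) (mono 1ℤ 0 0 n) one)) ⟩
  sumQ ΔL
    ≈⟨ sumQ-reindex ΔL aq (λ m → X m ⊗ Qinv m) (λ n → q^∣-⊗ʳ n (mono 1ℤ 0 0 n ⊖ one) (q^n∣X⊗Qinv n)) q^n∣X⊗Qinv ΔL-zero ΔL-suc ⟩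
  aq ⊗ L ∎
  where open SetoidReasoning setoid

A∞-unfold : A∞ ≈ (one ⊕ aq) ⊗ dilate 1 0 A∞
A∞-unfold = pochInf-unfold 1ℤ 1 0 1 0 refl

atA0-A∞ : atA0 A∞ ≈ one
atA0-A∞ zero    j N = atA0-poch N 0 j N
  where
  atA0-poch : ∀ n → atA0 (poch 1ℤ 1 0 n) ≈ one
  atA0-poch n = trans (atA0-prod1to n _) (prod1to-one n λ k →
    trans (atA0-⊕ one (mono 1ℤ 1 0 (suc k))) (trans (+-cong atA0-one (atA0-mono 1ℤ 0 0 (suc k))) (+-identityʳ one)))
atA0-A∞ (suc i) j N = refl

atA0-L : atA0 L ≈ one
atA0-L = begin
  atA0 L                                                      ≈⟨ atA0-cong (sumQ-unfoldˡ _ q^n∣X⊗Qinv) ⟩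
  atA0 (X 0 ⊗ Qinv 0 ⊕ sumQ (λ m → X (suc m) ⊗ Qinv (suc m)))  ≈⟨ atA0-⊕ (X 0 ⊗ Qinv 0) _ ⟩
  atA0 (one ⊗ one) ⊕ atA0 (sumQ (λ m → X (suc m) ⊗ Qinv (suc m)))
    ≈⟨ +-cong (trans (atA0-cong (*-identityˡ one)) atA0-one) (trans (atA0-sumQ _) higher-terms) ⟩
  one ⊕ 0#                                                    ≈⟨ +-identityʳ one ⟩
  one                                                         ∎
  where
  open SetoidReasoning setoid
  higher-terms : sumQ (λ m → atA0 (X (suc m) ⊗ Qinv (suc m))) ≈ 0#
  higher-terms i j N = sumTo-zero N λ m _ →
    trans (atA0-⊗ (X (suc m)) (Qinv (suc m)))
          (trans (⊗-congʳ (atA0 (Qinv (suc m))) (atA0-mono (-1ℤ ℤ.^ suc m) m 0 (suc m))) (zeroˡ (atA0 (Qinv (suc m))))) i j N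

euler-identity : A∞ ⊗ L ≈ one
euler-identity = dilate-a-invariant (A∞ ⊗ L) invariant
  (trans (atA0-⊗ A∞ L) (trans (*-cong atA0-A∞ atA0-L) (*-identityˡ one)))
  where
  open SetoidReasoning setoid
  dilate-L : dilate 1 0 L ≈ L ⊗ (one ⊕ aq)
  dilate-L = begin
    dilate 1 0 L                             ≈⟨ ⊕-⊖-cancel (dilate 1 0 L) L ⟨
    L ⊕ (dilate 1 0 L ⊖ L)                   ≈⟨ ⊕-congˡ L L-difference ⟩
    L ⊕ aq ⊗ L                    ≈⟨ +-cong (*-identityʳ L) (*-comm L (aq)) ⟨
    L ⊗ one ⊕ L ⊗ aq              ≈⟨ distribˡ L one (aq) ⟨
    L ⊗ (one ⊕ aq)                ∎
  invariant : dilate 1 0 (A∞ ⊗ L) ≈ A∞ ⊗ L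
  invariant = begin
    dilate 1 0 (A∞ ⊗ L)                       ≈⟨ dilate-⊗ 1 0 A∞ L ⟩
    dilate 1 0 A∞ ⊗ dilate 1 0 L              ≈⟨ ⊗-congˡ (dilate 1 0 A∞) dilate-L ⟩
    dilate 1 0 A∞ ⊗ (L ⊗ (one ⊕ aq)) ≈⟨ ⊗-solve 3 (λ t l y → t · (l · y) ⊜ (y · t) · l) ≈-refl (dilate 1 0 A∞) L (one ⊕ aq) ⟩
    (one ⊕ aq) ⊗ dilate 1 0 A∞ ⊗ L ≈⟨ ⊗-congʳ L A∞-unfold ⟨
    A∞ ⊗ L                                    ∎

atZ0-1+zq^ : ∀ k → atZ0 (1+zq^ k) ≈ one
atZ0-1+zq^ k = trans (atZ0-⊕ one (mono 1ℤ 0 1 k)) (trans (+-cong atZ0-one (atZ0-mono 1ℤ 0 0 k)) (+-identityʳ one))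

atZ0-Z∞ : atZ0 Z∞ ≈ one
atZ0-Z∞ i zero    N = trans (atZ0-prod1to N 1+zq^) (prod1to-one N (λ k → atZ0-1+zq^ (suc k))) i 0 N
atZ0-Z∞ i (suc j) N = atZ0-one i (suc j) N

atZ0-Winv : ∀ n → atZ0 (Winv n) ≈ one
atZ0-Winv n = trans (atZ0-prod1to n 1/1+zq^) (prod1to-one n λ k → begin
  atZ0 (1/1+zq^ (suc k))                           ≈⟨ *-identityʳ _ ⟨
  atZ0 (1/1+zq^ (suc k)) ⊗ one                     ≈⟨ ⊗-congˡ (atZ0 (1/1+zq^ (suc k))) (atZ0-1+zq^ (suc k)) ⟨
  atZ0 (1/1+zq^ (suc k)) ⊗ atZ0 (1+zq^ (suc k))    ≈⟨ atZ0-inverse {1/1+zq^ (suc k)} {1+zq^ (suc k)} (geomInv-inverse 1ℤ 0 1 k) ⟩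
  one                                              ∎)
  where open SetoidReasoning setoid

rhs2-isSolution : IsSolution rhs2
rhs2-isSolution = record
  { initial = begin
      atZ0 (A∞ ⊗ Z∞ ⊗ S)              ≈⟨ trans (atZ0-⊗ (A∞ ⊗ Z∞) S) (⊗-congʳ (atZ0 S) (atZ0-⊗ A∞ Z∞)) ⟩
      atZ0 A∞ ⊗ atZ0 Z∞ ⊗ atZ0 S      ≈⟨ *-cong (*-cong (z-free-pochInf 1ℤ 1) atZ0-Z∞) (trans (atZ0-sumQ _) (sumQ-cong atZ0-term)) ⟩
      A∞ ⊗ one ⊗ L                    ≈⟨ ⊗-congʳ L (*-identityʳ A∞) ⟩
      A∞ ⊗ L                          ≈⟨ euler-identity ⟩
      one                             ∎
  ; step = functional-equation⇒step rhs2 rhs2-functional-equation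
  }
  where
  open SetoidReasoning setoid
  atZ0-term : ∀ n → atZ0 (X n ⊗ Qinv n ⊗ Winv n) ≈ X n ⊗ Qinv n
  atZ0-term n = trans (atZ0-⊗ (X n ⊗ Qinv n) (Winv n))
    (trans (*-cong (z-free-⊗ (z-free-X n) (z-free-Qinv n)) (atZ0-Winv n)) (*-identityʳ (X n ⊗ Qinv n)))

-- Counting by the recurrence

Card : Set → ℤ → Set
Card A z = Σ ℕ λ c → (Fin c ↔ A) × (ℤ.+ c ≡ z)

card-≡ : ∀ {A x y} → x ≡ y → Card A x → Card A y
card-≡ x≡y (c , Fin↔A , c≡x) = c , Fin↔A , ≡.trans c≡x x≡y

card-↔ : ∀ {A B x} → A ↔ B → Card A x → Card B x
card-↔ A↔B (c , Fin↔A , c≡x) = c , ↔-trans Fin↔A A↔B , c≡x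

card-⊥ : ∀ {A} → (A → ⊥) → Card A 0ℤ
card-⊥ ¬A = 0 , ↔-trans 0↔⊥ (mk↔ₛ′ ⊥-elim ¬A (λ a → ⊥-elim (¬A a)) λ ()) , refl

card-⊎ : ∀ {A B x y} → Card A x → Card B y → Card (A ⊎ B) (x ℤ.+ y)
card-⊎ (c , Fin↔A , c≡x) (d , Fin↔B , d≡y) =
  c ℕ.+ d , ↔-trans (+↔⊎ {c}) (Fin↔A ⊎-↔ Fin↔B) , ≡.trans (ℤₚ.pos-+ c d) (≡.cong₂ ℤ._+_ c≡x d≡y)

Shift : ℕ → (ℕ → Set) → ℕ → Set
Shift a T N = a ≤ N × T (N ∸ a)

card-shift : ∀ a N {T : ℕ → Set} {φ} → (a ≤ N → Card (T (N ∸ a)) (φ (N ∸ a))) → Card (Shift a T N) ((q^ a · φ) N)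
card-shift a N {T} card with a ℕ.≤? N
... | no  a≰N = card-≡ (≡.sym ([≤]-false _ (ℕₚ.≰⇒> a≰N))) (card-⊥ (λ (a≤N , _) → a≰N a≤N))
... | yes a≤N = card-≡ (≡.sym ([≤]-true _ a≤N)) (card-↔ with-proof (card a≤N))
  where
  with-proof : T (N ∸ a) ↔ Shift a T N
  with-proof = mk↔ₛ′ (a≤N ,_) proj₂ (λ (a≤N′ , t) → ≡.cong (_, t) (ℕₚ.≤-irrelevant a≤N a≤N′)) (λ _ → refl)

ExtraT : (ℕ → ℕ → ℕ → Set) → ℕ → ℕ → ℕ → Set
ExtraT T zero    j = λ _ → ⊥
ExtraT T (suc i) j = Shift (suc j) (T i j)

card-by-recurrence : ∀ (T : ℕ → ℕ → ℕ → Set) {F} → IsSolution F →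
  (∀ i N → Card (T i 0 N) (one i 0 N)) →
  (∀ i j N → T i (suc j) N ↔ Shift (suc j) (λ M → T i (suc j) M ⊎ T i j M ⊎ ExtraT T i j M) N) →
  ∀ i j N → Card (T i j N) (F i j N)
card-by-recurrence T {F} F-sol initial decomposition = lex-induction (λ i j N → Card (T i j N) (F i j N)) base step
  where
  module F = IsSolution F-sol
  base : ∀ i N → Card (T i 0 N) (F i 0 N)
  base i N = card-≡ (≡.sym (F.initial i 0 N)) (initial i N)
  step : ∀ j N → (∀ i M → Card (T i j M) (F i j M)) → (∀ i M → M < N → Card (T i (suc j) M) (F i (suc j) M)) →
         ∀ i → Card (T i (suc j) N) (F i (suc j) N)
  step j N card card′ i = card-≡ (≡.sym (F.step i j N)) (card-↔ (↔-sym (decomposition i j N))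
    (card-shift (suc j) N {λ M → T i (suc j) M ⊎ T i j M ⊎ ExtraT T i j M}
                           {λ M → F i (suc j) M ℤ.+ F i j M ℤ.+ extra F i j M} λ 1+j≤N →
       card-≡ (≡.sym (ℤₚ.+-assoc (F i (suc j) (N ∸ suc j)) (F i j (N ∸ suc j)) (extra F i j (N ∸ suc j))))
         (card-⊎ (card′ i _ (shifted< j 1+j≤N)) (card-⊎ (card i (N ∸ suc j)) (card-extra i (N ∸ suc j))))))
    where
    card-extra : ∀ i M → Card (ExtraT T i j M) (extra F i j M)
    card-extra zero     M = card-⊥ λ ()
    card-extra (suc i′) M = card-shift (suc j) M {T i′ j} {F i′ j} λ _ → card i′ (M ∸ suc j)

-- Strict overpartitions

raise : ℕ → OPart → OPart → OPart
raise k t []            = t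
raise k t ((p , b) ∷ r) = (k ℕ.+ p , b) ∷ raise k t r

data Kind : Set where
  plain endsInOne endsInTwoBar : Kind

offset : Kind → ℕ
offset plain        = 1
offset endsInOne    = 1
offset endsInTwoBar = 2

ending : Kind → OPart
ending plain        = []
ending endsInOne    = (1 , false) ∷ []
ending endsInTwoBar = (2 , true) ∷ []

-- build κ r undoes "subtract 1 from every part" (plain), "subtract 1 from every part and drop the part 1"
-- (endsInOne) or "subtract 2 from every part and drop the part 2̄" (endsInTwoBar).
build : Kind → OPart → OPart
build κ = raise (offset κ) (ending κ)

numParts-raise : ∀ k t r → numParts (raise k t r) ≡ numParts r ℕ.+ numParts t
numParts-raise k t []            = refl
numParts-raise k t ((p , b) ∷ r) = ≡.cong suc (numParts-raise k t r)

numOver-raise : ∀ k t r → numOver (raise k t r) ≡ numOver r ℕ.+ numOver t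
numOver-raise k t []                = refl
numOver-raise k t ((p , true)  ∷ r) = ≡.cong suc (numOver-raise k t r)
numOver-raise k t ((p , false) ∷ r) = numOver-raise k t r

size-raise : ∀ k t r → size (raise k t r) ≡ k ℕ.* numParts r ℕ.+ size r ℕ.+ size t
size-raise k t []            = ≡.sym (≡.cong (ℕ._+ size t) (≡.trans (ℕₚ.+-identityʳ (k ℕ.* 0)) (ℕₚ.*-zeroʳ k)))
size-raise k t ((p , b) ∷ r) = ≡.trans (≡.cong ((k ℕ.+ p) ℕ.+_) (size-raise k t r))
  (regroup k p (numParts r) (size r) (size t))
  where
  open +-*-Solver
  regroup : ∀ k p n s u → (k ℕ.+ p) ℕ.+ (k ℕ.* n ℕ.+ s ℕ.+ u) ≡ k ℕ.* suc n ℕ.+ (p ℕ.+ s) ℕ.+ u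
  regroup = solve 5 (λ k p n s u → (k :+ p) :+ (k :* n :+ s :+ u) := k :* (con 1 :+ n) :+ (p :+ s) :+ u) refl

OvOK-raise : ∀ b k {p m m′} → m′ ≤ k ℕ.+ m → OvOK b p m → OvOK b (k ℕ.+ p) m′
OvOK-raise false k _ _ = tt
OvOK-raise true  k {p} {m} {m′} m′≤k+m (2≤p , 2+m≤p) = ℕₚ.≤-trans 2≤p (ℕₚ.m≤n+m p k) , (begin
  2 ℕ.+ m′        ≤⟨ ℕₚ.+-monoʳ-≤ 2 m′≤k+m ⟩
  2 ℕ.+ (k ℕ.+ m) ≡⟨ x∙yz≈y∙xz 2 k m ⟩
  k ℕ.+ (2 ℕ.+ m) ≤⟨ ℕₚ.+-monoʳ-≤ k 2+m≤p ⟩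
  k ℕ.+ p         ∎)
  where
  open ℕₚ.≤-Reasoning
  open import Algebra.Properties.CommutativeSemigroup ℕₚ.+-commutativeSemigroup using (x∙yz≈y∙xz)

next-raise : ∀ k t r → next t ≤ k → next (raise k t r) ≤ k ℕ.+ next r
next-raise k t []            t≤k = ≡.subst (next t ≤_) (≡.sym (ℕₚ.+-identityʳ k)) t≤k
next-raise k t ((p , b) ∷ r) t≤k = ℕₚ.≤-refl

raise-valid : ∀ k t r → IsStrictOverpartition t → next t ≤ k → IsStrictOverpartition r → IsStrictOverpartition (raise k t r)
raise-valid k t []            t-valid t≤k _                  = t-valid
raise-valid k t ((p , b) ∷ r) t-valid t≤k (r-valid , r<p , ov) =
  raise-valid k t r t-valid t≤k r-valid ,
  ℕₚ.≤-<-trans (next-raise k t r t≤k) (ℕₚ.+-monoʳ-< k r<p) ,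
  OvOK-raise b k (next-raise k t r t≤k) ov

build-valid : ∀ κ r → IsStrictOverpartition r → IsStrictOverpartition (build κ r)
build-valid plain        r = raise-valid 1 [] r tt z≤n
build-valid endsInOne    r = raise-valid 1 ((1 , false) ∷ []) r (tt , s≤s z≤n , tt) ℕₚ.≤-refl
build-valid endsInTwoBar r = raise-valid 2 ((2 , true) ∷ []) r (tt , s≤s z≤n , ℕₚ.≤-refl , ℕₚ.≤-refl) ℕₚ.≤-refl

classifyLast : ℕ → Bool → Kind × OPart
classifyLast 1 false = endsInOne , []
classifyLast 2 true  = endsInTwoBar , []
classifyLast p b     = plain , (p ∸ 1 , b) ∷ []

-- The smallest part is the last entry; it determines the kind, and the other parts are lowered by its offset.
classify : OPart → Kind × OPart
classify []                = plain , []
classify ((p , b) ∷ [])    = classifyLast p b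
classify ((p , b) ∷ x ∷ l) = lowerHead (classify (x ∷ l))
  where
  lowerHead : Kind × OPart → Kind × OPart
  lowerHead (κ , r) = κ , (p ∸ offset κ , b) ∷ r

Decomposes : OPart → Kind × OPart → Set
Decomposes l (κ , r) = IsStrictOverpartition r × build κ r ≡ l

offset≤next : ∀ κ r → build κ r ≢ [] → offset κ ≤ next (build κ r)
offset≤next plain        []            build≢[] = ⊥-elim (build≢[] refl)
offset≤next endsInOne    []            _        = ℕₚ.≤-refl
offset≤next endsInTwoBar []            _        = ℕₚ.≤-refl
offset≤next κ            ((p , b) ∷ r) _        = ℕₚ.m≤m+n (offset κ) p

next-build-∸ : ∀ κ r → next (build κ r) ∸ offset κ ≡ next r
next-build-∸ plain        []            = refl
next-build-∸ endsInOne    []            = refl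
next-build-∸ endsInTwoBar []            = refl
next-build-∸ κ            ((p , b) ∷ r) = ℕₚ.m+n∸m≡n (offset κ) p

classifyLast-decomposes : ∀ p b → 0 < p → OvOK b p 0 → Decomposes ((p , b) ∷ []) (classifyLast p b)
classifyLast-decomposes 1                   false _ _           = tt , refl
classifyLast-decomposes 1                   true  _ (s≤s () , _)
classifyLast-decomposes 2                   true  _ _           = tt , refl
classifyLast-decomposes 2                   false _ _           = (tt , s≤s z≤n , tt) , refl
classifyLast-decomposes (suc (suc (suc p))) b     _ _           = (tt , s≤s z≤n , ov b) , refl
  where
  ov : ∀ b → OvOK b (suc (suc p)) 0
  ov false = tt
  ov true  = s≤s (s≤s z≤n) , s≤s (s≤s z≤n)

prepend-decomposes : ∀ p b {l κ r} → l ≢ [] → next l < p → OvOK b p (next l) →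
  Decomposes l (κ , r) → Decomposes ((p , b) ∷ l) (κ , (p ∸ offset κ , b) ∷ r)
prepend-decomposes p b {κ = κ} {r} l≢[] n<p ov (r-valid , refl) =
  (r-valid , r<p∸k , ov′ b ov) , ≡.cong (λ p′ → (p′ , b) ∷ build κ r) (ℕₚ.m+[n∸m]≡n k≤p)
  where
  k = offset κ
  n = next (build κ r)
  k≤n : k ≤ n
  k≤n = offset≤next κ r l≢[]
  k≤p : k ≤ p
  k≤p = ℕₚ.≤-trans k≤n (ℕₚ.<⇒≤ n<p)
  r<p∸k : next r < p ∸ k
  r<p∸k = ≡.subst (_< p ∸ k) (next-build-∸ κ r) (ℕₚ.∸-monoˡ-< n<p k≤n)
  ov′ : ∀ b → OvOK b p n → OvOK b (p ∸ k) (next r)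
  ov′ false _            = tt
  ov′ true  (_ , 2+n≤p) = ℕₚ.≤-trans (ℕₚ.m≤m+n 2 (next r)) 2+r≤p∸k , 2+r≤p∸k
    where
    2+r≤p∸k : 2 ℕ.+ next r ≤ p ∸ k
    2+r≤p∸k = ≡.subst (λ m → 2 ℕ.+ m ≤ p ∸ k) (next-build-∸ κ r)
                (≡.subst (_≤ p ∸ k) (ℕₚ.+-∸-assoc 2 k≤n) (ℕₚ.∸-monoˡ-≤ k 2+n≤p))

classify-decomposes : ∀ l → IsStrictOverpartition l → Decomposes l (classify l)
classify-decomposes []                _                   = tt , refl
classify-decomposes ((p , b) ∷ [])    (_ , 0<p , ov)      = classifyLast-decomposes p b 0<p ov
classify-decomposes ((p , b) ∷ x ∷ l) (l-valid , n<p , ov) =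
  prepend-decomposes p b (λ ()) n<p ov (classify-decomposes (x ∷ l) l-valid)

classify-build : ∀ κ r → IsStrictOverpartition r → build κ r ≢ [] → classify (build κ r) ≡ (κ , r)
classify-build plain        []            _ build≢[] = ⊥-elim (build≢[] refl)
classify-build endsInOne    []            _ _ = refl
classify-build endsInTwoBar []            _ _ = refl
classify-build plain        ((p , b) ∷ []) (_ , 0<p , ov) _ = last p b 0<p ov
  where
  last : ∀ p b → 0 < p → OvOK b p 0 → classifyLast (suc p) b ≡ (plain , (p , b) ∷ [])
  last 1                 false _ _            = refl
  last 1                 true  _ (s≤s () , _)
  last (suc (suc p))     b     _ _            = refl
classify-build endsInOne    ((p , b) ∷ []) _ _ = ≡.cong (λ p′ → endsInOne , (p′ , b) ∷ []) (ℕₚ.m+n∸m≡n 1 p)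
classify-build endsInTwoBar ((p , b) ∷ []) _ _ = ≡.cong (λ p′ → endsInTwoBar , (p′ , b) ∷ []) (ℕₚ.m+n∸m≡n 2 p)
classify-build κ ((p , b) ∷ (q , c) ∷ r) (r-valid , _ , _) _
  rewrite classify-build κ ((q , c) ∷ r) r-valid (λ ()) =
  ≡.cong (λ p′ → κ , (p′ , b) ∷ (q , c) ∷ r) (ℕₚ.m+n∸m≡n (offset κ) p)

OvOK-irrelevant : ∀ b p m (u v : OvOK b p m) → u ≡ v
OvOK-irrelevant false p m tt       tt       = refl
OvOK-irrelevant true  p m (u , u′) (v , v′) = ≡.cong₂ _,_ (ℕₚ.≤-irrelevant u v) (ℕₚ.≤-irrelevant u′ v′)

IsStrictOverpartition-irrelevant : ∀ l (u v : IsStrictOverpartition l) → u ≡ v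
IsStrictOverpartition-irrelevant []            tt               tt               = refl
IsStrictOverpartition-irrelevant ((p , b) ∷ l) (u , n<p , ov) (v , n<p′ , ov′) =
  ≡.cong₂ _,_ (IsStrictOverpartition-irrelevant l u v) (≡.cong₂ _,_ (ℕₚ.<-irrelevant n<p n<p′) (OvOK-irrelevant b p (next l) ov ov′))

SOP-≡ : ∀ {i j N} (x y : SOP i j N) → proj₁ x ≡ proj₁ y → x ≡ y
SOP-≡ (l , v , o , n , s) (.l , v′ , o′ , n′ , s′) refl
  rewrite IsStrictOverpartition-irrelevant l v v′ | ℕₚ.≡-irrelevant o o′ | ℕₚ.≡-irrelevant n n′ | ℕₚ.≡-irrelevant s s′ = refl

module _ (r : OPart) where
  open +-*-Solver
  private
    n = numParts r
    s = size r

  plain-stats : numOver (build plain r) ≡ numOver r × numParts (build plain r) ≡ n × size (build plain r) ≡ n ℕ.+ s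
  plain-stats = ≡.trans (numOver-raise 1 [] r) (ℕₚ.+-identityʳ _) , ≡.trans (numParts-raise 1 [] r) (ℕₚ.+-identityʳ n) ,
    ≡.trans (size-raise 1 [] r) (solve 2 (λ n s → con 1 :* n :+ s :+ con 0 := n :+ s) refl n s)

  endsInOne-stats : numOver (build endsInOne r) ≡ numOver r × numParts (build endsInOne r) ≡ suc n ×
                    size (build endsInOne r) ≡ suc n ℕ.+ s
  endsInOne-stats = ≡.trans (numOver-raise 1 _ r) (ℕₚ.+-identityʳ _) , ≡.trans (numParts-raise 1 _ r) (ℕₚ.+-comm n 1) ,
    ≡.trans (size-raise 1 _ r) (solve 2 (λ n s → con 1 :* n :+ s :+ con 1 := con 1 :+ n :+ s) refl n s)

  endsInTwoBar-stats : numOver (build endsInTwoBar r) ≡ suc (numOver r) × numParts (build endsInTwoBar r) ≡ suc n ×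
                       size (build endsInTwoBar r) ≡ suc n ℕ.+ (suc n ℕ.+ s)
  endsInTwoBar-stats = ≡.trans (numOver-raise 2 _ r) (ℕₚ.+-comm _ 1) , ≡.trans (numParts-raise 2 _ r) (ℕₚ.+-comm n 1) ,
    ≡.trans (size-raise 2 _ r) (solve 2 (λ n s → con 2 :* n :+ s :+ con 2 := (con 1 :+ n) :+ ((con 1 :+ n) :+ s)) refl n s)

Classified : ℕ → ℕ → ℕ → Set
Classified i j M = SOP i (suc j) M ⊎ SOP i j M ⊎ ExtraT SOP i j M

shape : ∀ {i j M} → Classified i j M → Kind × OPart
shape           (inj₁ x)                = plain , proj₁ x
shape           (inj₂ (inj₁ x))         = endsInOne , proj₁ x
shape {suc i}   (inj₂ (inj₂ (_ , x)))   = endsInTwoBar , proj₁ x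

∸-intro : ∀ a {s N} → a ℕ.+ s ≡ N → s ≡ N ∸ a
∸-intro a {s} refl = ≡.sym (ℕₚ.m+n∸m≡n a s)

toClassified : ∀ {i j N} κ r → IsStrictOverpartition r →
  numOver (build κ r) ≡ i → numParts (build κ r) ≡ suc j → size (build κ r) ≡ N → Classified i j (N ∸ suc j)
toClassified {j = j} plain r r-valid o np sz =
  let o≡ , n≡ , s≡ = plain-stats r
      n≡1+j = ≡.trans (≡.sym n≡) np
  in inj₁ (r , r-valid , ≡.trans (≡.sym o≡) o , n≡1+j ,
           ∸-intro (suc j) (≡.trans (≡.cong (ℕ._+ size r) (≡.sym n≡1+j)) (≡.trans (≡.sym s≡) sz)))
toClassified {j = j} endsInOne r r-valid o np sz =
  let o≡ , n≡ , s≡ = endsInOne-stats r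
      n≡j = ℕₚ.suc-injective (≡.trans (≡.sym n≡) np)
  in inj₂ (inj₁ (r , r-valid , ≡.trans (≡.sym o≡) o , n≡j ,
                 ∸-intro (suc j) (≡.trans (≡.cong (λ n → suc n ℕ.+ size r) (≡.sym n≡j)) (≡.trans (≡.sym s≡) sz))))
toClassified {zero} endsInTwoBar r r-valid o np sz = ⊥-elim (ℕₚ.1+n≢0 (≡.trans (≡.sym (proj₁ (endsInTwoBar-stats r))) o))
toClassified {suc i} {j} {N} endsInTwoBar r r-valid o np sz =
  let o≡ , n≡ , s≡ = endsInTwoBar-stats r
      n≡j = ℕₚ.suc-injective (≡.trans (≡.sym n≡) np)
      N∸1+j≡ = ∸-intro (suc j) (≡.trans (≡.cong (λ n → suc n ℕ.+ (suc n ℕ.+ size r)) (≡.sym n≡j)) (≡.trans (≡.sym s≡) sz))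
  in inj₂ (inj₂ (≡.subst (suc j ≤_) N∸1+j≡ (ℕₚ.m≤m+n (suc j) (size r)) ,
                 (r , r-valid , ℕₚ.suc-injective (≡.trans (≡.sym o≡) o) , n≡j , ∸-intro (suc j) N∸1+j≡)))

fromClassified : ∀ {i j N} → suc j ≤ N → Classified i j (N ∸ suc j) → SOP i (suc j) N
fromClassified {j = j} 1+j≤N (inj₁ (r , r-valid , o , np , sz)) =
  let o≡ , n≡ , s≡ = plain-stats r
  in build plain r , build-valid plain r r-valid , ≡.trans o≡ o , ≡.trans n≡ np ,
     ≡.trans s≡ (≡.trans (≡.cong₂ ℕ._+_ np sz) (ℕₚ.m+[n∸m]≡n 1+j≤N))
fromClassified {j = j} 1+j≤N (inj₂ (inj₁ (r , r-valid , o , np , sz))) =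
  let o≡ , n≡ , s≡ = endsInOne-stats r
  in build endsInOne r , build-valid endsInOne r r-valid , ≡.trans o≡ o , ≡.trans n≡ (≡.cong suc np) ,
     ≡.trans s≡ (≡.trans (≡.cong₂ (λ n s → suc n ℕ.+ s) np sz) (ℕₚ.m+[n∸m]≡n 1+j≤N))
fromClassified {suc i} {j} 1+j≤N (inj₂ (inj₂ (1+j≤N∸1+j , (r , r-valid , o , np , sz)))) =
  let o≡ , n≡ , s≡ = endsInTwoBar-stats r
  in build endsInTwoBar r , build-valid endsInTwoBar r r-valid , ≡.trans o≡ (≡.cong suc o) , ≡.trans n≡ (≡.cong suc np) ,
     ≡.trans s≡ (≡.trans (≡.cong₂ (λ n s → suc n ℕ.+ (suc n ℕ.+ s)) np sz)
                         (≡.trans (≡.cong (suc j ℕ.+_) (ℕₚ.m+[n∸m]≡n 1+j≤N∸1+j)) (ℕₚ.m+[n∸m]≡n 1+j≤N)))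

fromClassified-build : ∀ {i j N} (1+j≤N : suc j ≤ N) (c : Classified i j (N ∸ suc j)) →
  proj₁ (fromClassified 1+j≤N c) ≡ build (proj₁ (shape c)) (proj₂ (shape c))
fromClassified-build         _ (inj₁ _)        = refl
fromClassified-build         _ (inj₂ (inj₁ _)) = refl
fromClassified-build {suc i} _ (inj₂ (inj₂ _)) = refl

shape-toClassified : ∀ {i j N} κ r r-valid o np sz → shape (toClassified {i} {j} {N} κ r r-valid o np sz) ≡ (κ , r)
shape-toClassified         plain        r _ _ _ _ = refl
shape-toClassified         endsInOne    r _ _ _ _ = refl
shape-toClassified {zero}  endsInTwoBar r _ o _ _ = ⊥-elim (ℕₚ.1+n≢0 (≡.trans (≡.sym (proj₁ (endsInTwoBar-stats r))) o))
shape-toClassified {suc i} endsInTwoBar r _ _ _ _ = refl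

Classified-≡ : ∀ {i j M} (c c′ : Classified i j M) → shape c ≡ shape c′ → c ≡ c′
Classified-≡         (inj₁ x)               (inj₁ y)               eq = ≡.cong inj₁ (SOP-≡ x y (≡.cong proj₂ eq))
Classified-≡         (inj₂ (inj₁ x))        (inj₂ (inj₁ y))        eq = ≡.cong (inj₂ ∘ inj₁) (SOP-≡ x y (≡.cong proj₂ eq))
Classified-≡ {suc i} (inj₂ (inj₂ (le , x))) (inj₂ (inj₂ (le′ , y))) eq =
  ≡.cong (inj₂ ∘ inj₂) (≡.cong₂ _,_ (ℕₚ.≤-irrelevant le le′) (SOP-≡ x y (≡.cong proj₂ eq)))
Classified-≡         (inj₁ _)               (inj₂ (inj₁ _))        ()
Classified-≡         (inj₂ (inj₁ _))        (inj₁ _)               ()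
Classified-≡ {suc i} (inj₁ _)               (inj₂ (inj₂ _))        ()
Classified-≡ {suc i} (inj₂ (inj₁ _))        (inj₂ (inj₂ _))        ()
Classified-≡ {suc i} (inj₂ (inj₂ _))        (inj₁ _)               ()
Classified-≡ {suc i} (inj₂ (inj₂ _))        (inj₂ (inj₁ _))        ()

shape-valid : ∀ {i j M} (c : Classified i j M) → IsStrictOverpartition (proj₂ (shape c))
shape-valid         (inj₁ (_ , r-valid , _))             = r-valid
shape-valid         (inj₂ (inj₁ (_ , r-valid , _)))      = r-valid
shape-valid {suc i} (inj₂ (inj₂ (_ , (_ , r-valid , _)))) = r-valid

numParts≤size : ∀ l → IsStrictOverpartition l → numParts l ≤ size l
numParts≤size []                _           = z≤n
numParts≤size ((zero  , b) ∷ l) (_ , () , _)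
numParts≤size ((suc p , b) ∷ l) (l-valid , _ , _) = s≤s (ℕₚ.≤-trans (numParts≤size l l-valid) (ℕₚ.m≤n+m (size l) p))

sop-decomposition : ∀ i j N → SOP i (suc j) N ↔ Shift (suc j) (Classified i j) N
sop-decomposition i j N = mk↔ₛ′ to from to∘from from∘to
  where
  decompose : SOP i (suc j) N → Classified i j (N ∸ suc j)
  decompose (l , l-valid , o , np , sz) =
    let r-valid , build≡l = classify-decomposes l l-valid
    in toClassified (proj₁ (classify l)) (proj₂ (classify l)) r-valid
         (≡.trans (≡.cong numOver build≡l) o) (≡.trans (≡.cong numParts build≡l) np) (≡.trans (≡.cong size build≡l) sz)

  shape-decompose : ∀ x → shape (decompose x) ≡ classify (proj₁ x)
  shape-decompose (l , l-valid , o , np , sz) = shape-toClassified (proj₁ (classify l)) (proj₂ (classify l)) _ _ _ _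

  to : SOP i (suc j) N → Shift (suc j) (Classified i j) N
  to x@(l , l-valid , _ , np , sz) = ≡.subst₂ _≤_ np sz (numParts≤size l l-valid) , decompose x

  from : Shift (suc j) (Classified i j) N → SOP i (suc j) N
  from (1+j≤N , c) = fromClassified 1+j≤N c

  to∘from : ∀ y → to (from y) ≡ y
  to∘from (1+j≤N , c) = ≡.cong₂ _,_ (ℕₚ.≤-irrelevant _ _) (Classified-≡ (decompose x) c (begin
    shape (decompose x)                                   ≡⟨ shape-decompose x ⟩
    classify (proj₁ x)                                    ≡⟨ ≡.cong classify (fromClassified-build 1+j≤N c) ⟩
    classify (build (proj₁ (shape c)) (proj₂ (shape c)))  ≡⟨ classify-build _ _ (shape-valid c) build≢[] ⟩
    shape c                                               ∎))
    where
    open ≡.≡-Reasoning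
    x = fromClassified 1+j≤N c
    build≢[] : build (proj₁ (shape c)) (proj₂ (shape c)) ≢ []
    build≢[] build≡[] = ℕₚ.1+n≢0 (≡.trans (≡.sym (proj₁ (proj₂ (proj₂ (proj₂ x)))))
                                          (≡.cong numParts (≡.trans (fromClassified-build 1+j≤N c) build≡[])))

  from∘to : ∀ x → from (to x) ≡ x
  from∘to x@(l , l-valid , _) = SOP-≡ (from (to x)) x (begin
    proj₁ (from (to x))                                             ≡⟨ fromClassified-build (proj₁ (to x)) (decompose x) ⟩
    build (proj₁ (shape (decompose x))) (proj₂ (shape (decompose x))) ≡⟨ ≡.cong (λ (κ , r) → build κ r) (shape-decompose x) ⟩
    build (proj₁ (classify l)) (proj₂ (classify l))                 ≡⟨ proj₂ (classify-decomposes l l-valid) ⟩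
    l                                                               ∎)
    where open ≡.≡-Reasoning

sop-initial : ∀ i N → Card (SOP i 0 N) (one i 0 N)
sop-initial zero    zero    =
  1 , mk↔ₛ′ (λ _ → ∅) (λ _ → Data.Fin.zero) (λ x → SOP-≡ ∅ x (≡.sym (no-parts x))) (λ { Data.Fin.zero → refl ; (Data.Fin.suc ()) }) ,
  refl
  where
  ∅ : SOP 0 0 0
  ∅ = [] , tt , refl , refl , refl
  no-parts : (x : SOP 0 0 0) → proj₁ x ≡ []
  no-parts ([]    , _)              = refl
  no-parts ((_ ∷ _) , _ , _ , () , _)
sop-initial zero    (suc N) = card-⊥ λ { ([] , _ , _ , _ , ()) ; ((_ ∷ _) , _ , _ , () , _) }
sop-initial (suc i) N       = card-⊥ λ { ([] , _ , () , _ , _) ; ((_ ∷ _) , _ , _ , () , _) }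

theorem4p5 :
    ((i j N : ℕ) → Σ ℕ (λ c → (Fin c ↔ SOP i j N) × (+ c ≡ rhs1 i j N)))
    × ((i j N : ℕ) → rhs1 i j N ≡ rhs2 i j N)
theorem4p5 = card-by-recurrence SOP rhs1-isSolution sop-initial sop-decomposition ,
             solution-unique rhs1-isSolution rhs2-isSolution
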